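{- Let $n\ge 5$. Among all graphs in $\mathcal{G}_3(n,n+2)$, the graph $T_n$ is the unique graph (up to isomorphism) maximizing the Randić index $R(G)=\sum_{uv\in E(G)}\frac{1}{\sqrt{d(u)d(v)}}$.
   Context: For integers $n,m$, $\mathcal{G}_3(n,m)$ denotes the set of simple connected undirected graphs with $n$ vertices, $m$ edges and maximum degree at most $3$; $d(u)$ denotes the degree of vertex $u$. The graph $T_n$ is obtained from a path $P_{n-2}$ on $n-2$ vertices with endpoints $a,b$ by adding two new adjacent vertices $u,v$, each joined to both $a$ and $b$; equivalently, $T_n$ has exactly five edges joining two vertices of degree $3$, two edges joining a vertex of degree $2$ and a vertex of degree $3$, and no vertices of degree $1$. -}

module Defs where

open import Data.Nat as ℕ using (ℕ; zero; suc; _≡ᵇ_; _<ᵇ_)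
open import Data.Fin using (Fin; toℕ)
open import Data.Bool using (Bool; true; false; _∧_; _∨_; if_then_else_)
open import Data.List using (List; []; _∷_; allFin; concatMap; length; foldr)
open import Data.Product using (Σ; ∃; _×_; _,_)
open import Data.Integer using (+_)
open import Data.Rational as ℚ using (ℚ; 0ℚ; 1ℚ; _/_)
open import Function.Bundles using (_↔_; Inverse)
open import Relation.Binary.PropositionalEquality using (_≡_)

Graph : ℕ → Set
Graph n = Fin n → Fin n → Bool

countTrue : List Bool → ℕ
countTrue []           = 0
countTrue (true ∷ bs)  = suc (countTrue bs)
countTrue (false ∷ bs) = countTrue bs

Data-map : ∀ {A B : Set} → (A → B) → List A → List B
Data-map f []       = []
Data-map f (x ∷ xs) = f x ∷ Data-map f xs

degree : ∀ {n} → Graph n → Fin n → ℕ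
degree {n} G u = countTrue (Data-map (G u) (allFin n))

edges : ∀ {n} → Graph n → List (Fin n × Fin n)
edges {n} G = concatMap (λ i → concatMap (λ j →
  if (toℕ i <ᵇ toℕ j) ∧ G i j then (i , j) ∷ [] else []) (allFin n)) (allFin n)

edgeCount : ∀ {n} → Graph n → ℕ
edgeCount G = length (edges G)

Simple : ∀ {n} → Graph n → Set
Simple G = (∀ i j → G i j ≡ G j i) × (∀ i → G i i ≡ false)

data Walk {n} (G : Graph n) : Fin n → Fin n → Set where
  here : ∀ {u} → Walk G u u
  step : ∀ {u w v} → G u w ≡ true → Walk G w v → Walk G u v

Connected : ∀ {n} → Graph n → Set
Connected G = ∀ u v → Walk G u v

MaxDegree≤3 : ∀ {n} → Graph n → Set
MaxDegree≤3 G = ∀ u → degree G u ℕ.≤ 3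

InG3 : (n m : ℕ) → Graph n → Set
InG3 n m G = Simple G × Connected G × (edgeCount G ≡ m) × MaxDegree≤3 G

Iso : ∀ {n} → Graph n → Graph n → Set
Iso {n} G H = Σ (Fin n ↔ Fin n) λ σ →
  ∀ i j → H (Inverse.to σ i) (Inverse.to σ j) ≡ G i j

-- T_n: path 0 - 1 - ... - (n-3) (a = 0, b = n-3), plus u = n-2, v = n-1,
-- with edges uv, ua, ub, va, vb.
edgeT : ℕ → ℕ → ℕ → Bool   -- directed description, x < y
edgeT n x y =
     ((suc x ≡ᵇ y) ∧ (y <ᵇ (n ℕ.∸ 2)))
  ∨ ((x ≡ᵇ (n ℕ.∸ 2)) ∧ (y ≡ᵇ (n ℕ.∸ 1)))
  ∨ ((x ≡ᵇ 0) ∧ ((y ≡ᵇ (n ℕ.∸ 2)) ∨ (y ≡ᵇ (n ℕ.∸ 1))))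
  ∨ ((x ≡ᵇ (n ℕ.∸ 3)) ∧ ((y ≡ᵇ (n ℕ.∸ 2)) ∨ (y ≡ᵇ (n ℕ.∸ 1))))

T : (n : ℕ) → Graph n
T n i j = edgeT n (toℕ i) (toℕ j) ∨ edgeT n (toℕ j) (toℕ i)

-- Real-number-free treatment of the Randić index.
-- A bounds certificate gives rationals lo k ≤ 1/√k ≤ hi k for every k ≥ 1
-- (encoded as lo k ≥ 0, lo k² · k ≤ 1, hi k ≥ 0, 1 ≤ hi k² · k).
ℕtoℚ : ℕ → ℚ
ℕtoℚ k = (+ k) / 1

record InvSqrtBounds : Set where
  field
    lo hi  : ℕ → ℚ
    lo-nonneg : ∀ k → 0ℚ ℚ.≤ lo k
    lo-ok     : ∀ k → 1 ℕ.≤ k → (lo k ℚ.* lo k) ℚ.* ℕtoℚ k ℚ.≤ 1ℚ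
    hi-nonneg : ∀ k → 0ℚ ℚ.≤ hi k
    hi-ok     : ∀ k → 1 ℕ.≤ k → 1ℚ ℚ.≤ (hi k ℚ.* hi k) ℚ.* ℕtoℚ k

sumℚ : List ℚ → ℚ
sumℚ = foldr ℚ._+_ 0ℚ

randicWith : ∀ {n} → (ℕ → ℚ) → Graph n → ℚ
randicWith f G = sumℚ (Data-map (λ { (i , j) → f (degree G i ℕ.* degree G j) }) (edges G))

-- R(G) < R(H)  (as real numbers), certified by rational bounds:
-- an upper bound for R(G) strictly below a lower bound for R(H).
RandicLt : ∀ {n} → Graph n → Graph n → Set
RandicLt G H = ∃ λ (B : InvSqrtBounds) →
  randicWith (InvSqrtBounds.hi B) G ℚ.< randicWith (InvSqrtBounds.lo B) H

module Submission where

-- For an edge with end degrees a and b,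
--   1/√(ab) = (1/a + 1/b)/2 − (1/√a − 1/√b)²/2,
-- and 1/a + 1/b summed over the edges is n, so R(G) = n/2 − (gap of G)/2 where edges joining
-- equal degrees have gap zero.  Scaled by 720 and with 1/√k replaced by rational upper or lower
-- bounds, gaps become natural numbers: an edge at a vertex of degree 1 costs at least 30, an edge
-- joining degrees 2 and 3 costs 6 (7 with the lower bounds).  T_n has two edges of the latter
-- kind, so its gap is 14 with the lower bounds, and every other G must have gap at least 15.
--
-- Without vertices of degree 1, G has exactly four vertices of degree 3 by degree counting.  If
-- at most two edges join degree 3 to degree 2, walk from a degree-3 vertex a through degree-2
-- vertices up to the next degree-3 vertex b.  Then b ≠ a, the other two degree-3 vertices c, d
-- carry no such edge, so they are adjacent to each other and to a and b; c, d and the walk are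
-- closed under adjacency, so by connectivity they are all of G, and G ≅ T_n.  Otherwise the gap
-- is at least 3 · 6 = 18.

open import Defs
open import Algebra.Properties.CommutativeSemigroup as CommSemigroup using (x∙yz≈y∙xz)
open import Data.Bool as Bool using (Bool; true; false; _∧_; _∨_; if_then_else_) renaming (T to IsTrue)
open import Data.Bool.Properties using (∧-zeroʳ; ∧-identityʳ; ∨-comm; T-≡; T-∨; T-∧; ⇔→≡)
open import Data.Empty using (⊥; ⊥-elim)
open import Data.Fin as Fin using (Fin; toℕ; fromℕ<)
open import Data.Fin.Properties using (toℕ-injective; toℕ<n; toℕ-fromℕ<; any?; injective⇒≤)
import Data.Integer as ℤ
import Data.Integer.Properties as ℤ
open import Data.List using (List; []; _∷_; _++_; length; map; filter; allFin; tabulate; concatMap; cartesianProduct)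
open import Data.List.Membership.Propositional using (_∈_; _∉_)
open import Data.List.Membership.Propositional.Properties
  using (∈-∃++; ∈-++⁻; ∈-++⁺ˡ; ∈-++⁺ʳ; ∈-filter⁺; ∈-filter⁻; ∈-allFin; ∈-cartesianProduct⁺; ∈-concatMap⁺;
         ∈-map⁺; ∈-map⁻)
import Data.List.Membership.DecPropositional as DecMembership
open import Data.List.Properties using (map-++; map-cong; map-∘; length-tabulate; length-map; length-++)
open import Data.List.Relation.Binary.Subset.Propositional using (_⊆_)
open import Data.List.Relation.Unary.All as All using (All; []; _∷_)
open import Data.List.Relation.Unary.Any as Any using (here; there)
open import Data.List.Relation.Unary.Unique.Propositional using (Unique; []; _∷_)
open import Data.List.Relation.Unary.Unique.Propositional.Properties using (filter⁺; allFin⁺; cartesianProduct⁺; map⁺; ++⁺)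
open import Data.Nat using (ℕ; zero; suc; _+_; _*_; _∸_; _≤_; _<_; z≤n; s≤s; _≡ᵇ_; _<ᵇ_; _≟_; _≤?_)
open import Data.Nat.ListAction using (sum)
open import Data.Nat.ListAction.Properties using (sum-++)
open import Data.Nat.Properties
open import Algebra.Properties.Semiring.Sum +-*-semiring using (sum-syntax; sum-cong-≗; ∑-distrib-+; ∑-comm; *-distribˡ-sum)
open import Data.Product as Product using (∃; _×_; _,_; proj₁; proj₂)
open import Data.Product.Properties using (,-injectiveˡ; ,-injectiveʳ)
open import Data.Rational as ℚ using (ℚ; 1ℚ; toℚᵘ)
import Data.Rational.Properties as ℚ
open import Data.Rational.Properties using (toℚᵘ-fromℚᵘ; toℚᵘ-injective; toℚᵘ-homo-+; toℚᵘ-cancel-<; toℚᵘ-cancel-≤)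
  renaming (≤ᵇ⇒≤ to ℚ≤ᵇ⇒≤)
open import Data.Rational.Unnormalised as ℚᵘ using (mkℚᵘ; *≡*; *<*; *≤*)
import Data.Rational.Unnormalised.Properties as ℚᵘ
open import Data.Sum as Sum using (_⊎_; inj₁; inj₂; [_,_]′)
open import Function using (_∘_; const; case_of_)
open import Function.Bundles using (Equivalence; _⇔_; mk⇔; _↔_; mk↔ₛ′)
open import Relation.Binary.Definitions using (DecidableEquality; tri<; tri≈; tri>)
open import Relation.Binary.PropositionalEquality
open import Relation.Nullary using (¬_; Dec; yes; no; does; contradiction; _×-dec_; ¬?)
open import Relation.Nullary.Reflects using (ofʸ; ofⁿ)
open import Relation.Unary using (Decidable)

module _ {A : Set} where

  private
    sum-map-insert : ∀ (f : A → ℕ) ys {x} zs → sum (map f (ys ++ x ∷ zs)) ≡ f x + sum (map f (ys ++ zs))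
    sum-map-insert f [] zs = refl
    sum-map-insert f (y ∷ ys) {x} zs = begin
      f y + sum (map f (ys ++ x ∷ zs))     ≡⟨ cong (f y +_) (sum-map-insert f ys zs) ⟩
      f y + (f x + sum (map f (ys ++ zs))) ≡⟨ x∙yz≈y∙xz +-commutativeSemigroup (f y) (f x) _ ⟩
      f x + (f y + sum (map f (ys ++ zs))) ∎
      where open ≡-Reasoning

  sum-map-mono-⊆ : ∀ (f : A → ℕ) {xs ys} → Unique xs → xs ⊆ ys → sum (map f xs) ≤ sum (map f ys)
  sum-map-mono-⊆ f {[]} _ _ = z≤n
  sum-map-mono-⊆ f {x ∷ xs} (x∉xs ∷ uxs) xs⊆ys with ∈-∃++ (xs⊆ys (here refl))
  ... | ys₁ , ys₂ , refl = begin
    f x + sum (map f xs)           ≤⟨ +-monoʳ-≤ (f x) (sum-map-mono-⊆ f uxs xs⊆ys₁++ys₂) ⟩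
    f x + sum (map f (ys₁ ++ ys₂)) ≡⟨ sum-map-insert f ys₁ ys₂ ⟨
    sum (map f (ys₁ ++ x ∷ ys₂))   ∎
    where
      open ≤-Reasoning
      xs⊆ys₁++ys₂ : xs ⊆ ys₁ ++ ys₂
      xs⊆ys₁++ys₂ z∈xs with ∈-++⁻ ys₁ (xs⊆ys (there z∈xs))
      ... | inj₁ z∈ys₁         = ∈-++⁺ˡ z∈ys₁
      ... | inj₂ (here refl)   = contradiction refl (All.lookup x∉xs z∈xs)
      ... | inj₂ (there z∈ys₂) = ∈-++⁺ʳ ys₁ z∈ys₂

  length≡sum-map-1 : ∀ (xs : List A) → length xs ≡ sum (map (const 1) xs)
  length≡sum-map-1 []       = refl
  length≡sum-map-1 (x ∷ xs) = cong suc (length≡sum-map-1 xs)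

  length-mono-⊆ : ∀ {xs ys : List A} → Unique xs → xs ⊆ ys → length xs ≤ length ys
  length-mono-⊆ {xs} {ys} uxs xs⊆ys =
    subst₂ _≤_ (sym (length≡sum-map-1 xs)) (sym (length≡sum-map-1 ys)) (sum-map-mono-⊆ (const 1) uxs xs⊆ys)

  ⊆-length⇒⊇ : DecidableEquality A → ∀ {xs ys : List A} → Unique xs → xs ⊆ ys → length ys ≤ length xs → ys ⊆ xs
  ⊆-length⇒⊇ _≟_ {xs} {ys} uxs xs⊆ys len {y} y∈ys with DecMembership._∈?_ _≟_ y xs
  ... | yes y∈xs = y∈xs
  ... | no y∉xs = contradiction (≤-trans (length-mono-⊆ (y∉xs′ ∷ uxs) y∷xs⊆ys) len) 1+n≰n
    where
      y∉xs′ : All (y ≢_) xs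
      y∉xs′ = All.tabulate λ { z∈xs refl → y∉xs z∈xs }
      y∷xs⊆ys : y ∷ xs ⊆ ys
      y∷xs⊆ys (here refl)  = y∈ys
      y∷xs⊆ys (there z∈xs) = xs⊆ys z∈xs

length-≡-by-injection : ∀ {A B : Set} (f : A → B) → (∀ {x y} → f x ≡ f y → x ≡ y) →
  ∀ {xs ys} → Unique xs → Unique ys →
  (∀ {x} → x ∈ xs → f x ∈ ys) → (∀ {y} → y ∈ ys → ∃ λ x → x ∈ xs × f x ≡ y) → length xs ≡ length ys
length-≡-by-injection f f-injective {xs} uxs uys into onto = trans (sym (length-map f xs)) (≤-antisym
  (length-mono-⊆ (map⁺ f-injective uxs) (λ y∈ → case ∈-map⁻ f y∈ of λ { (x , x∈ , refl) → into x∈ }))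
  (length-mono-⊆ uys (λ y∈ → case onto y∈ of λ { (x , x∈ , refl) → ∈-map⁺ f x∈ })))

sum-map-+ : ∀ {A : Set} (f g : A → ℕ) xs → sum (map (λ x → f x + g x) xs) ≡ sum (map f xs) + sum (map g xs)
sum-map-+ f g []       = refl
sum-map-+ f g (x ∷ xs) = trans (cong (f x + g x +_) (sum-map-+ f g xs)) (CommSemigroup.interchange +-commutativeSemigroup (f x) (g x) _ _)

sum-map-* : ∀ {A : Set} c (f : A → ℕ) xs → sum (map (λ x → c * f x) xs) ≡ c * sum (map f xs)
sum-map-* c f []       = sym (*-zeroʳ c)
sum-map-* c f (x ∷ xs) = trans (cong (c * f x +_) (sum-map-* c f xs)) (sym (*-distribˡ-+ c (f x) _))

∈⇒≤sum-map : ∀ {A : Set} (f : A → ℕ) {x xs} → x ∈ xs → f x ≤ sum (map f xs)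
∈⇒≤sum-map f {xs = y ∷ ys} (here refl)  = m≤m+n (f y) _
∈⇒≤sum-map f {xs = y ∷ ys} (there x∈ys) = ≤-trans (∈⇒≤sum-map f x∈ys) (m≤n+m _ (f y))

infix 8 _when_
_when_ : ℕ → Bool → ℕ
x when b = if b then x else 0

length-filter≡sum-map-when : ∀ {A : Set} {P : A → Set} (P? : Decidable P) xs →
  length (filter P? xs) ≡ sum (map (λ x → 1 when does (P? x)) xs)
length-filter≡sum-map-when P? [] = refl
length-filter≡sum-map-when P? (x ∷ xs) with does (P? x)
... | true  = cong suc (length-filter≡sum-map-when P? xs)
... | false = length-filter≡sum-map-when P? xs

countTrue-map≡length-filter : ∀ {A : Set} (P : A → Bool) xs →
  countTrue (Data-map P xs) ≡ length (filter (λ x → P x Bool.≟ true) xs)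
countTrue-map≡length-filter P [] = refl
countTrue-map≡length-filter P (x ∷ xs) with P x
... | true  = cong suc (countTrue-map≡length-filter P xs)
... | false = countTrue-map≡length-filter P xs

length-≥-of-cover : ∀ {n} {xs : List (Fin n)} → (∀ x → x ∈ xs) → n ≤ length xs
length-≥-of-cover {n} {xs} cover = subst (_≤ length xs) (length-tabulate (λ i → i)) (length-mono-⊆ (allFin⁺ n) (λ {x} _ → cover x))

∑-const : ∀ n c → ∑[ i < n ] c ≡ n * c
∑-const zero    c = refl
∑-const (suc n) c = cong (c +_) (∑-const n c)

sum-map-tabulate : ∀ {A : Set} {n} (X : A → ℕ) (g : Fin n → A) → sum (map X (tabulate g)) ≡ ∑[ i < n ] X (g i)
sum-map-tabulate {n = zero}  X g = refl
sum-map-tabulate {n = suc n} X g = cong (X (g Fin.zero) +_) (sum-map-tabulate X (g ∘ Fin.suc))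

countTrue-map-tabulate : ∀ {A : Set} {n} (P : A → Bool) (g : Fin n → A) →
  countTrue (Data-map P (tabulate g)) ≡ ∑[ i < n ] (1 when P (g i))
countTrue-map-tabulate {n = zero}  P g = refl
countTrue-map-tabulate {n = suc n} P g with P (g Fin.zero)
... | true  = cong suc (countTrue-map-tabulate P (g ∘ Fin.suc))
... | false = countTrue-map-tabulate P (g ∘ Fin.suc)

sum-map-++ : ∀ {A : Set} (X : A → ℕ) xs {ys} → sum (map X (xs ++ ys)) ≡ sum (map X xs) + sum (map X ys)
sum-map-++ X xs {ys} = trans (cong sum (map-++ X xs ys)) (sum-++ (map X xs) (map X ys))

sum-map-concatMap-tabulate : ∀ {A B : Set} {n} (X : B → ℕ) (f : A → List B) (g : Fin n → A) →
  sum (map X (concatMap f (tabulate g))) ≡ ∑[ i < n ] sum (map X (f (g i)))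
sum-map-concatMap-tabulate {n = zero}  X f g = refl
sum-map-concatMap-tabulate {n = suc n} X f g =
  trans (sum-map-++ X (f (g Fin.zero))) (cong (sum (map X (f (g Fin.zero))) +_) (sum-map-concatMap-tabulate X f (g ∘ Fin.suc)))

sum-map-cartesianProduct : ∀ {A B : Set} {n} (X : A × B → ℕ) (g : Fin n → A) ys →
  sum (map X (cartesianProduct (tabulate g) ys)) ≡ ∑[ i < n ] sum (map (λ y → X (g i , y)) ys)
sum-map-cartesianProduct {n = zero}  X g ys = refl
sum-map-cartesianProduct {n = suc n} X g ys =
  trans (sum-map-++ X (map (g Fin.zero ,_) ys)) (cong₂ _+_ (cong sum (sym (map-∘ ys))) (sum-map-cartesianProduct X (g ∘ Fin.suc) ys))

module _ {n : ℕ} (G : Graph n) where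

  nbrs : Fin n → List (Fin n)
  nbrs u = filter (λ v → G u v Bool.≟ true) (allFin n)

  degree≡length-nbrs : ∀ u → degree G u ≡ length (nbrs u)
  degree≡length-nbrs u = countTrue-map≡length-filter (G u) (allFin n)

  degree≡∑ : ∀ u → degree G u ≡ ∑[ v < n ] (1 when G u v)
  degree≡∑ u = countTrue-map-tabulate (G u) (λ v → v)

  ∈-nbrs⁺ : ∀ {u v} → G u v ≡ true → v ∈ nbrs u
  ∈-nbrs⁺ {v = v} = ∈-filter⁺ _ (∈-allFin v)

  ∈-nbrs⁻ : ∀ {u v} → v ∈ nbrs u → G u v ≡ true
  ∈-nbrs⁻ {u} = proj₂ ∘ ∈-filter⁻ (λ v → G u v Bool.≟ true) {xs = allFin n}

  nbrs-unique : ∀ u → Unique (nbrs u)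
  nbrs-unique u = filter⁺ _ (allFin⁺ n)

  Adjacent-to : Fin n → List (Fin n) → Set
  Adjacent-to u vs = All (λ v → G u v ≡ true) vs

  Neighbourhood : Fin n → List (Fin n) → Set
  Neighbourhood u vs = ∀ {v} → G u v ≡ true ⇔ v ∈ vs

  degree-≥ : ∀ {u vs} → Unique vs → Adjacent-to u vs → length vs ≤ degree G u
  degree-≥ {u} uvs adj = subst (_ ≤_) (sym (degree≡length-nbrs u)) (length-mono-⊆ uvs (∈-nbrs⁺ ∘ All.lookup adj))

  degree-≤ : ∀ {u vs} → (∀ {v} → G u v ≡ true → v ∈ vs) → degree G u ≤ length vs
  degree-≤ {u} cover = subst (_≤ _) (sym (degree≡length-nbrs u)) (length-mono-⊆ (nbrs-unique u) (cover ∘ ∈-nbrs⁻))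

  neighbourhood : ∀ {u vs} → Unique vs → Adjacent-to u vs → degree G u ≤ length vs → Neighbourhood u vs
  neighbourhood {u} uvs adj deg = mk⇔
    (⊆-length⇒⊇ Fin._≟_ uvs (∈-nbrs⁺ ∘ All.lookup adj) (subst (_≤ _) (degree≡length-nbrs u) deg) ∘ ∈-nbrs⁺)
    (All.lookup adj)

  nbrs-saturate : ∀ {u vs} → (∀ {v} → G u v ≡ true → v ∈ vs) → length vs ≤ degree G u → Adjacent-to u vs
  nbrs-saturate {u} cover deg =
    All.tabulate (∈-nbrs⁻ ∘ ⊆-length⇒⊇ Fin._≟_ (nbrs-unique u) (cover ∘ ∈-nbrs⁻) (subst (_ ≤_) (degree≡length-nbrs u) deg))

  module _ (simple : Simple G) where

    adjacent-sym : ∀ {u v} → G u v ≡ true → G v u ≡ true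
    adjacent-sym {u} {v} = trans (proj₁ simple v u)

    adjacent⇒≢ : ∀ {u v} → G u v ≡ true → u ≢ v
    adjacent⇒≢ {u} uv refl = contradiction (trans (sym uv) (proj₂ simple u)) λ ()

module _ {n : ℕ} (G : Graph n) where

  private
    below : Fin n → Fin n → Bool
    below i j = (toℕ i <ᵇ toℕ j) ∧ G i j

    cell : Fin n → Fin n → List (Fin n × Fin n)
    cell i j = if below i j then (i , j) ∷ [] else []

    row : Fin n → List (Fin n × Fin n)
    row i = concatMap (cell i) (allFin n)

  sum-edges : ∀ (X : Fin n × Fin n → ℕ) → sum (map X (edges G)) ≡ ∑[ i < n ] ∑[ j < n ] (X (i , j) when below i j)
  sum-edges X = begin
    sum (map X (edges G))                        ≡⟨ sum-map-concatMap-tabulate X row (λ i → i) ⟩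
    ∑[ i < n ] sum (map X (row i))               ≡⟨ sum-cong-≗ (λ i → sum-map-concatMap-tabulate X (cell i) (λ j → j)) ⟩
    ∑[ i < n ] ∑[ j < n ] sum (map X (cell i j)) ≡⟨ sum-cong-≗ (λ i → sum-cong-≗ (λ j → sum-cell i j)) ⟩
    ∑[ i < n ] ∑[ j < n ] (X (i , j) when below i j) ∎
    where
      open ≡-Reasoning
      sum-cell : ∀ i j → sum (map X (cell i j)) ≡ X (i , j) when below i j
      sum-cell i j with below i j
      ... | true  = +-identityʳ _
      ... | false = refl

  ∈-edges : ∀ {u v} → G u v ≡ true → toℕ u < toℕ v → (u , v) ∈ edges G
  ∈-edges {u} {v} uv u<v =
    ∈-concatMap⁺ row (Any.map (λ { refl → ∈-concatMap⁺ (cell u) (Any.map (λ { refl → ∈-cell }) (∈-allFin v)) }) (∈-allFin u))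
    where
      ∈-cell : (u , v) ∈ cell u v
      ∈-cell rewrite Equivalence.to T-≡ (<⇒<ᵇ u<v) | uv = here refl

  module _ (simple : Simple G) where

    private
      when-orient : ∀ x i j → x when below i j + x when below j i ≡ x when G i j
      when-orient x i j rewrite proj₁ simple j i with G i j in ij
      ... | false rewrite ∧-zeroʳ (toℕ i <ᵇ toℕ j) | ∧-zeroʳ (toℕ j <ᵇ toℕ i) = refl
      ... | true rewrite ∧-identityʳ (toℕ i <ᵇ toℕ j) | ∧-identityʳ (toℕ j <ᵇ toℕ i)
        with toℕ i <ᵇ toℕ j | <ᵇ-reflects-< (toℕ i) (toℕ j) | toℕ j <ᵇ toℕ i | <ᵇ-reflects-< (toℕ j) (toℕ i)
      ...   | true  | ofʸ i<j | true  | ofʸ j<i = contradiction i<j (<-asym j<i)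
      ...   | true  | _       | false | _       = +-identityʳ x
      ...   | false | _       | true  | _       = refl
      ...   | false | ofⁿ i≮j | false | ofⁿ j≮i =
        contradiction (toℕ-injective (≤-antisym (≮⇒≥ j≮i) (≮⇒≥ i≮j))) (adjacent⇒≢ G simple ij)

      when-+ : ∀ b x y → (x + y) when b ≡ x when b + y when b
      when-+ true  x y = refl
      when-+ false x y = refl

    -- edges G lists each edge once, in increasing order; the reversed copy is re-indexed by ∑-comm.
    sum-edges-sym : ∀ (F : Fin n → Fin n → ℕ) →
      sum (map (λ e → F (proj₁ e) (proj₂ e) + F (proj₂ e) (proj₁ e)) (edges G)) ≡ ∑[ i < n ] ∑[ j < n ] (F i j when G i j)
    sum-edges-sym F = begin
      sum (map (λ e → F (proj₁ e) (proj₂ e) + F (proj₂ e) (proj₁ e)) (edges G))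
        ≡⟨ sum-edges _ ⟩
      ∑[ i < n ] ∑[ j < n ] ((F i j + F j i) when below i j)
        ≡⟨ sum-cong-≗ (λ i → trans (sum-cong-≗ (λ j → when-+ (below i j) (F i j) (F j i))) (∑-distrib-+ (fwd i) (bwd i))) ⟩
      ∑[ i < n ] (∑[ j < n ] fwd i j + ∑[ j < n ] bwd i j)
        ≡⟨ ∑-distrib-+ (λ i → ∑[ j < n ] fwd i j) (λ i → ∑[ j < n ] bwd i j) ⟩
      ∑[ i < n ] ∑[ j < n ] fwd i j + ∑[ i < n ] ∑[ j < n ] bwd i j
        ≡⟨ cong (∑[ i < n ] ∑[ j < n ] fwd i j +_) (∑-comm bwd) ⟩
      ∑[ i < n ] ∑[ j < n ] fwd i j + ∑[ i < n ] ∑[ j < n ] bwd j i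
        ≡⟨ ∑-distrib-+ (λ i → ∑[ j < n ] fwd i j) (λ i → ∑[ j < n ] bwd j i) ⟨
      ∑[ i < n ] (∑[ j < n ] fwd i j + ∑[ j < n ] bwd j i)
        ≡⟨ sum-cong-≗ (λ i → trans (sym (∑-distrib-+ (fwd i) (λ j → bwd j i))) (sum-cong-≗ (λ j → when-orient (F i j) i j))) ⟩
      ∑[ i < n ] ∑[ j < n ] (F i j when G i j) ∎
      where
        open ≡-Reasoning
        fwd bwd : Fin n → Fin n → ℕ
        fwd i j = F i j when below i j
        bwd i j = F j i when below i j

    sum-edges-endpoint : ∀ (h : Fin n → ℕ) →
      sum (map (λ e → h (proj₁ e) + h (proj₂ e)) (edges G)) ≡ ∑[ i < n ] (degree G i * h i)
    sum-edges-endpoint h = begin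
      sum (map (λ e → h (proj₁ e) + h (proj₂ e)) (edges G))
        ≡⟨ sum-edges-sym (λ i _ → h i) ⟩
      ∑[ i < n ] ∑[ j < n ] (h i when G i j)
        ≡⟨ sum-cong-≗ (λ i → sum-cong-≗ (λ j → when-* (G i j) (h i))) ⟩
      ∑[ i < n ] ∑[ j < n ] (h i * (1 when G i j))
        ≡⟨ sum-cong-≗ (λ i → *-distribˡ-sum (h i) (λ j → 1 when G i j)) ⟨
      ∑[ i < n ] (h i * ∑[ j < n ] (1 when G i j))
        ≡⟨ sum-cong-≗ (λ i → trans (*-comm (h i) _) (cong (_* h i) (sym (degree≡∑ G i)))) ⟩
      ∑[ i < n ] (degree G i * h i) ∎
      where
        open ≡-Reasoning
        when-* : ∀ b x → x when b ≡ x * (1 when b)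
        when-* true  x = sym (*-identityʳ x)
        when-* false x = sym (*-zeroʳ x)

    handshake : 2 * edgeCount G ≡ ∑[ i < n ] degree G i
    handshake = begin
      2 * length (edges G)              ≡⟨ cong (2 *_) (length≡sum-map-1 (edges G)) ⟩
      2 * sum (map (const 1) (edges G)) ≡⟨ sum-map-* 2 (const 1) (edges G) ⟨
      sum (map (const 2) (edges G))     ≡⟨ sum-edges-endpoint (const 1) ⟩
      ∑[ i < n ] (degree G i * 1)       ≡⟨ sum-cong-≗ (λ i → *-identityʳ (degree G i)) ⟩
      ∑[ i < n ] degree G i             ∎
      where open ≡-Reasoning

module _ {n : ℕ} {G : Graph n} where

  walk-++ : ∀ {x y z} → Walk G x y → Walk G y z → Walk G x z
  walk-++ here            q = q
  walk-++ (step xw w⇝y) q = step xw (walk-++ w⇝y q)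

  walk-reverse : (∀ i j → G i j ≡ G j i) → ∀ {x y} → Walk G x y → Walk G y x
  walk-reverse sym-G here            = here
  walk-reverse sym-G (step xw w⇝y) = walk-++ (walk-reverse sym-G w⇝y) (step (trans (sym-G _ _) xw) here)

  connected-via-root : (∀ i j → G i j ≡ G j i) → ∀ r → (∀ i → Walk G i r) → Connected G
  connected-via-root sym-G r to-r i j = walk-++ (to-r i) (walk-reverse sym-G (to-r j))

module _ {n : ℕ} (G : Graph n) (connected : Connected G) where

    closed-set-is-everything : ∀ {P : Fin n → Set} → (∀ {x y} → G x y ≡ true → P x → P y) → ∀ {x} → P x → ∀ y → P y
    closed-set-is-everything {P} closed {x} px y = along (connected x y) px
      where
        along : ∀ {u v} → Walk G u v → P u → P v
        along here            pu = pu
        along (step uw w⇝v) pu = along w⇝v (closed uw pu)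

    crossing-edge : ∀ {P : Fin n → Set} → Decidable P → ∀ {x y} → P x → ¬ P y →
      ∃ λ u → ∃ λ v → G u v ≡ true × P u × ¬ P v
    crossing-edge {P} P? {x} {y} px ¬py = along (connected x y) px
      where
        along : ∀ {u} → Walk G u y → P u → ∃ λ u → ∃ λ v → G u v ≡ true × P u × ¬ P v
        along here pu = contradiction pu ¬py
        along (step {w = w} uw w⇝y) pu with P? w
        ... | yes pw  = along w⇝y pw
        ... | no ¬pw = _ , _ , uw , pu , ¬pw

Iso-by-relabelling : ∀ {n} {G H : Graph n} (τ : Fin n → Fin n) → (∀ {i j} → τ i ≡ τ j → i ≡ j) →
  (∀ w → ∃ λ i → τ i ≡ w) → (∀ i j → G (τ i) (τ j) ≡ H i j) → Iso G H
Iso-by-relabelling {n} {G} {H} τ τ-injective τ-surjective τ-adjacent = σ , λ i j → begin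
  H (τ⁻¹ i) (τ⁻¹ j)         ≡⟨ τ-adjacent (τ⁻¹ i) (τ⁻¹ j) ⟨
  G (τ (τ⁻¹ i)) (τ (τ⁻¹ j)) ≡⟨ cong₂ G (proj₂ (τ-surjective i)) (proj₂ (τ-surjective j)) ⟩
  G i j                     ∎
  where
    open ≡-Reasoning
    τ⁻¹ : Fin n → Fin n
    τ⁻¹ = proj₁ ∘ τ-surjective
    σ : Fin n ↔ Fin n
    σ = mk↔ₛ′ τ⁻¹ τ (λ w → τ-injective (proj₂ (τ-surjective (τ w)))) (proj₂ ∘ τ-surjective)

-- Rational certificates for the Randić index

scaled : ℕ → ℚ
scaled a = (ℤ.+ a) ℚ./ 720

private
  toℚᵘ-scaled : ∀ a → toℚᵘ (scaled a) ℚᵘ.≃ mkℚᵘ (ℤ.+ a) 719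
  toℚᵘ-scaled a = toℚᵘ-fromℚᵘ (mkℚᵘ (ℤ.+ a) 719)

scaled-+ : ∀ a b → scaled a ℚ.+ scaled b ≡ scaled (a + b)
scaled-+ a b = toℚᵘ-injective (begin-equality
  toℚᵘ (scaled a ℚ.+ scaled b)           ≃⟨ toℚᵘ-homo-+ (scaled a) (scaled b) ⟩
  toℚᵘ (scaled a) ℚᵘ.+ toℚᵘ (scaled b)   ≃⟨ ℚᵘ.+-cong (toℚᵘ-scaled a) (toℚᵘ-scaled b) ⟩
  mkℚᵘ (ℤ.+ a) 719 ℚᵘ.+ mkℚᵘ (ℤ.+ b) 719 ≃⟨ *≡* cross-multiplied ⟩
  mkℚᵘ (ℤ.+ (a + b)) 719                 ≃⟨ toℚᵘ-scaled (a + b) ⟨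
  toℚᵘ (scaled (a + b))                  ∎)
  where
    open ℚᵘ.≤-Reasoning
    cross-multiplied : (ℤ.+ a ℤ.* ℤ.+ 720 ℤ.+ ℤ.+ b ℤ.* ℤ.+ 720) ℤ.* ℤ.+ 720 ≡ ℤ.+ (a + b) ℤ.* (ℤ.+ 720 ℤ.* ℤ.+ 720)
    cross-multiplied = trans (cong (ℤ._* ℤ.+ 720) (sym (ℤ.*-distribʳ-+ (ℤ.+ 720) (ℤ.+ a) (ℤ.+ b))))
                             (ℤ.*-assoc (ℤ.+ (a + b)) (ℤ.+ 720) (ℤ.+ 720))

scaled-mono-≤ : ∀ {a b} → a ≤ b → scaled a ℚ.≤ scaled b
scaled-mono-≤ {a} {b} a≤b = toℚᵘ-cancel-≤ (begin
  toℚᵘ (scaled a)  ≃⟨ toℚᵘ-scaled a ⟩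
  mkℚᵘ (ℤ.+ a) 719 ≤⟨ *≤* (ℤ.*-monoʳ-≤-nonNeg (ℤ.+ 720) (ℤ.+≤+ a≤b)) ⟩
  mkℚᵘ (ℤ.+ b) 719 ≃⟨ toℚᵘ-scaled b ⟨
  toℚᵘ (scaled b)  ∎)
  where open ℚᵘ.≤-Reasoning

scaled-mono-< : ∀ {a b} → a < b → scaled a ℚ.< scaled b
scaled-mono-< {a} {b} a<b = toℚᵘ-cancel-< (begin-strict
  toℚᵘ (scaled a)  ≃⟨ toℚᵘ-scaled a ⟩
  mkℚᵘ (ℤ.+ a) 719 <⟨ *<* (ℤ.*-monoʳ-<-pos (ℤ.+ 720) (ℤ.+<+ a<b)) ⟩
  mkℚᵘ (ℤ.+ b) 719 ≃⟨ toℚᵘ-scaled b ⟨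
  toℚᵘ (scaled b)  ∎)
  where open ℚᵘ.≤-Reasoning

sumℚ-scaled : ∀ {A : Set} (f : A → ℕ) xs → sumℚ (Data-map (scaled ∘ f) xs) ≡ scaled (sum (map f xs))
sumℚ-scaled f []       = refl
sumℚ-scaled f (x ∷ xs) = trans (cong (scaled (f x) ℚ.+_) (sumℚ-scaled f xs)) (scaled-+ (f x) _)

-- 720/√k rounded up and down for the products k ∈ {1, 2, 3, 4, 6, 9} of two degrees at most 3;
-- elsewhere the trivial bounds 1 ≥ 1/√k ≥ 0.
upper720 lower720 : ℕ → ℕ
upper720 1 = 720
upper720 2 = 510
upper720 3 = 416
upper720 4 = 360
upper720 6 = 294
upper720 9 = 240
upper720 _ = 720
lower720 1 = 720
lower720 2 = 509
lower720 3 = 415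
lower720 4 = 360
lower720 6 = 293
lower720 9 = 240
lower720 _ = 0

private
  one≤ℕtoℚ : ∀ {k} → 1 ≤ k → 1ℚ ℚ.≤ ℕtoℚ k
  one≤ℕtoℚ {k} 1≤k = toℚᵘ-cancel-≤ (begin
    toℚᵘ 1ℚ        ≤⟨ *≤* (ℤ.*-monoʳ-≤-nonNeg (ℤ.+ 1) (ℤ.+≤+ 1≤k)) ⟩
    mkℚᵘ (ℤ.+ k) 0 ≃⟨ toℚᵘ-fromℚᵘ (mkℚᵘ (ℤ.+ k) 0) ⟨
    toℚᵘ (ℕtoℚ k)  ∎)
    where open ℚᵘ.≤-Reasoning

  lower720-ok : ∀ k → 1 ≤ k → (scaled (lower720 k) ℚ.* scaled (lower720 k)) ℚ.* ℕtoℚ k ℚ.≤ 1ℚ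
  lower720-ok 1 _ = ℚ≤ᵇ⇒≤ _
  lower720-ok 2 _ = ℚ≤ᵇ⇒≤ _
  lower720-ok 3 _ = ℚ≤ᵇ⇒≤ _
  lower720-ok 4 _ = ℚ≤ᵇ⇒≤ _
  lower720-ok 5 _ = ℚ≤ᵇ⇒≤ _
  lower720-ok 6 _ = ℚ≤ᵇ⇒≤ _
  lower720-ok 7 _ = ℚ≤ᵇ⇒≤ _
  lower720-ok 8 _ = ℚ≤ᵇ⇒≤ _
  lower720-ok 9 _ = ℚ≤ᵇ⇒≤ _
  lower720-ok k@(suc (suc (suc (suc (suc (suc (suc (suc (suc (suc _)))))))))) _ =
    subst (ℚ._≤ 1ℚ) (sym (ℚ.*-zeroˡ (ℕtoℚ k))) (ℚ≤ᵇ⇒≤ _)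

  upper720-ok : ∀ k → 1 ≤ k → 1ℚ ℚ.≤ (scaled (upper720 k) ℚ.* scaled (upper720 k)) ℚ.* ℕtoℚ k
  upper720-ok 1 _ = ℚ≤ᵇ⇒≤ _
  upper720-ok 2 _ = ℚ≤ᵇ⇒≤ _
  upper720-ok 3 _ = ℚ≤ᵇ⇒≤ _
  upper720-ok 4 _ = ℚ≤ᵇ⇒≤ _
  upper720-ok 5 _ = ℚ≤ᵇ⇒≤ _
  upper720-ok 6 _ = ℚ≤ᵇ⇒≤ _
  upper720-ok 7 _ = ℚ≤ᵇ⇒≤ _
  upper720-ok 8 _ = ℚ≤ᵇ⇒≤ _
  upper720-ok 9 _ = ℚ≤ᵇ⇒≤ _
  upper720-ok k@(suc (suc (suc (suc (suc (suc (suc (suc (suc (suc _)))))))))) 1≤k =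
    subst (1ℚ ℚ.≤_) (sym (ℚ.*-identityˡ (ℕtoℚ k))) (one≤ℕtoℚ 1≤k)

invSqrtBounds : InvSqrtBounds
invSqrtBounds = record
  { lo        = scaled ∘ lower720
  ; hi        = scaled ∘ upper720
  ; lo-nonneg = λ k → scaled-mono-≤ {0} {lower720 k} z≤n
  ; lo-ok     = lower720-ok
  ; hi-nonneg = λ k → scaled-mono-≤ {0} {upper720 k} z≤n
  ; hi-ok     = upper720-ok
  }

degreeProduct : ∀ {n} → Graph n → Fin n × Fin n → ℕ
degreeProduct G e = degree G (proj₁ e) * degree G (proj₂ e)

scaledRandic : ∀ {n} → Graph n → (ℕ → ℕ) → ℕ
scaledRandic G bound = sum (map (bound ∘ degreeProduct G) (edges G))

randicWith-scaled : ∀ {n} (bound : ℕ → ℕ) (G : Graph n) → randicWith (scaled ∘ bound) G ≡ scaled (scaledRandic G bound)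
randicWith-scaled bound G = sumℚ-scaled (bound ∘ degreeProduct G) (edges G)

RandicLt-by-720 : ∀ {n} (G H : Graph n) → scaledRandic G upper720 < scaledRandic H lower720 → RandicLt G H
RandicLt-by-720 G H lt =
  invSqrtBounds , subst₂ ℚ._<_ (sym (randicWith-scaled upper720 G)) (sym (randicWith-scaled lower720 H)) (scaled-mono-< lt)

-- Gaps

data Deg : ℕ → Set where
  deg1 : Deg 1
  deg2 : Deg 2
  deg3 : Deg 3

-- 720/(2d), so that over both ends of every edge these add up to 360 per vertex.
halfRecip720 : ℕ → ℕ
halfRecip720 1 = 360
halfRecip720 2 = 180
halfRecip720 3 = 120
halfRecip720 _ = 0

gap : (ℕ → ℕ) → ℕ → ℕ → ℕ
gap bound a b = halfRecip720 a + halfRecip720 b ∸ bound (a * b)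

upper720-≤ : ∀ {a b} → Deg a → Deg b → upper720 (a * b) ≤ halfRecip720 a + halfRecip720 b
upper720-≤ deg1 deg1 = ≤ᵇ⇒≤ _ _ _
upper720-≤ deg1 deg2 = ≤ᵇ⇒≤ _ _ _
upper720-≤ deg1 deg3 = ≤ᵇ⇒≤ _ _ _
upper720-≤ deg2 deg1 = ≤ᵇ⇒≤ _ _ _
upper720-≤ deg2 deg2 = ≤ᵇ⇒≤ _ _ _
upper720-≤ deg2 deg3 = ≤ᵇ⇒≤ _ _ _
upper720-≤ deg3 deg1 = ≤ᵇ⇒≤ _ _ _
upper720-≤ deg3 deg2 = ≤ᵇ⇒≤ _ _ _
upper720-≤ deg3 deg3 = ≤ᵇ⇒≤ _ _ _

lower720-≤ : ∀ {a b} → Deg a → Deg b → lower720 (a * b) ≤ halfRecip720 a + halfRecip720 b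
lower720-≤ deg1 deg1 = ≤ᵇ⇒≤ _ _ _
lower720-≤ deg1 deg2 = ≤ᵇ⇒≤ _ _ _
lower720-≤ deg1 deg3 = ≤ᵇ⇒≤ _ _ _
lower720-≤ deg2 deg1 = ≤ᵇ⇒≤ _ _ _
lower720-≤ deg2 deg2 = ≤ᵇ⇒≤ _ _ _
lower720-≤ deg2 deg3 = ≤ᵇ⇒≤ _ _ _
lower720-≤ deg3 deg1 = ≤ᵇ⇒≤ _ _ _
lower720-≤ deg3 deg2 = ≤ᵇ⇒≤ _ _ _
lower720-≤ deg3 deg3 = ≤ᵇ⇒≤ _ _ _

degree*halfRecip720 : ∀ {d} → Deg d → d * halfRecip720 d ≡ 360
degree*halfRecip720 deg1 = refl
degree*halfRecip720 deg2 = refl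
degree*halfRecip720 deg3 = refl

gap-comm : ∀ bound a b → gap bound a b ≡ gap bound b a
gap-comm bound a b = cong₂ _∸_ (+-comm (halfRecip720 a) (halfRecip720 b)) (cong bound (*-comm a b))

module _ {n : ℕ} (G : Graph n) where

  totalGap : (ℕ → ℕ) → ℕ
  totalGap bound = sum (map (λ e → gap bound (degree G (proj₁ e)) (degree G (proj₂ e))) (edges G))

  module _ (simple : Simple G) where

    scaledRandic+totalGap : (∀ u → Deg (degree G u)) → ∀ bound →
      (∀ {a b} → Deg a → Deg b → bound (a * b) ≤ halfRecip720 a + halfRecip720 b) →
      scaledRandic G bound + totalGap bound ≡ n * 360
    scaledRandic+totalGap deg bound bound-≤ = begin
      scaledRandic G bound + totalGap bound
        ≡⟨ sum-map-+ (bound ∘ degreeProduct G) (λ e → gap bound (d (proj₁ e)) (d (proj₂ e))) (edges G) ⟨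
      sum (map (λ e → bound (degreeProduct G e) + gap bound (d (proj₁ e)) (d (proj₂ e))) (edges G))
        ≡⟨ cong sum (map-cong (λ e → m+[n∸m]≡n (bound-≤ (deg (proj₁ e)) (deg (proj₂ e)))) (edges G)) ⟩
      sum (map (λ e → halfRecip720 (d (proj₁ e)) + halfRecip720 (d (proj₂ e))) (edges G))
        ≡⟨ sum-edges-endpoint G simple (halfRecip720 ∘ d) ⟩
      ∑[ i < n ] (d i * halfRecip720 (d i))
        ≡⟨ sum-cong-≗ (λ i → degree*halfRecip720 (deg i)) ⟩
      ∑[ i < n ] 360
        ≡⟨ ∑-const n 360 ⟩
      n * 360 ∎
      where
        open ≡-Reasoning
        d : Fin n → ℕ
        d = degree G

    gap≤totalGap : ∀ bound {u v} → G u v ≡ true → gap bound (degree G u) (degree G v) ≤ totalGap bound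
    gap≤totalGap bound {u} {v} uv with <-cmp (toℕ u) (toℕ v)
    ... | tri< u<v _ _ = ∈⇒≤sum-map (λ e → gap bound (degree G (proj₁ e)) (degree G (proj₂ e))) (∈-edges G uv u<v)
    ... | tri≈ _ u≡v _ = contradiction (toℕ-injective u≡v) (adjacent⇒≢ G simple uv)
    ... | tri> _ _ v<u = subst (_≤ totalGap bound) (gap-comm bound (degree G v) (degree G u))
      (∈⇒≤sum-map (λ e → gap bound (degree G (proj₁ e)) (degree G (proj₂ e))) (∈-edges G (adjacent-sym G simple uv) v<u))

    leaf⇒15≤totalGap : ∀ {u v} → G u v ≡ true → degree G u ≡ 1 → Deg (degree G v) → degree G v ≢ 1 → 15 ≤ totalGap upper720
    leaf⇒15≤totalGap {u} {v} uv du dv dv≢1 =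
      ≤-trans (leaf-gap dv dv≢1) (subst (λ k → gap upper720 k (degree G v) ≤ _) du (gap≤totalGap upper720 uv))
      where
        leaf-gap : ∀ {b} → Deg b → b ≢ 1 → 15 ≤ gap upper720 1 b
        leaf-gap deg1 b≢1 = contradiction refl b≢1
        leaf-gap deg2 _   = ≤ᵇ⇒≤ _ _ _
        leaf-gap deg3 _   = ≤ᵇ⇒≤ _ _ _

RandicLt-by-totalGap : ∀ {n} (G H : Graph n) → Simple G → (∀ u → Deg (degree G u)) → Simple H → (∀ u → Deg (degree H u)) →
  totalGap H lower720 < totalGap G upper720 → RandicLt G H
RandicLt-by-totalGap {n} G H simpleG degG simpleH degH lt = RandicLt-by-720 G H (+-cancelʳ-< _ _ _ (begin-strict
  scaledRandic G upper720 + totalGap H lower720 <⟨ +-monoʳ-< (scaledRandic G upper720) lt ⟩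
  scaledRandic G upper720 + totalGap G upper720 ≡⟨ scaledRandic+totalGap G simpleG degG upper720 upper720-≤ ⟩
  n * 360                                       ≡⟨ scaledRandic+totalGap H simpleH degH lower720 lower720-≤ ⟨
  scaledRandic H lower720 + totalGap H lower720 ∎))
  where open ≤-Reasoning

-- Graphs with all degrees 2 or 3

data Deg₂₃ : ℕ → Set where
  deg2 : Deg₂₃ 2
  deg3 : Deg₂₃ 3

Deg₂₃⇒Deg : ∀ {d} → Deg₂₃ d → Deg d
Deg₂₃⇒Deg deg2 = deg2
Deg₂₃⇒Deg deg3 = deg3

Deg₂₃⇒2≤ : ∀ {d} → Deg₂₃ d → 2 ≤ d
Deg₂₃⇒2≤ deg2 = ≤-refl
Deg₂₃⇒2≤ deg3 = n≤1+n 2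

Deg₂₃-≢2 : ∀ {d} → Deg₂₃ d → d ≢ 2 → d ≡ 3
Deg₂₃-≢2 deg2 d≢2 = contradiction refl d≢2
Deg₂₃-≢2 deg3 _   = refl

Deg₂₃-≢3 : ∀ {d} → Deg₂₃ d → d ≢ 3 → d ≡ 2
Deg₂₃-≢3 deg2 _   = refl
Deg₂₃-≢3 deg3 d≢3 = contradiction refl d≢3

crosses : ℕ → ℕ → Bool
crosses a b = does (a ≟ 3 ×-dec b ≟ 2)

gap-upper720 : ∀ {a b} → Deg₂₃ a → Deg₂₃ b → gap upper720 a b ≡ 6 * (1 when crosses a b) + 6 * (1 when crosses b a)
gap-upper720 deg2 deg2 = refl
gap-upper720 deg2 deg3 = refl
gap-upper720 deg3 deg2 = refl
gap-upper720 deg3 deg3 = refl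

gap-lower720 : ∀ {a b} → Deg₂₃ a → Deg₂₃ b → gap lower720 a b ≡ 7 * (1 when crosses a b) + 7 * (1 when crosses b a)
gap-lower720 deg2 deg2 = refl
gap-lower720 deg2 deg3 = refl
gap-lower720 deg3 deg2 = refl
gap-lower720 deg3 deg3 = refl

module _ {n : ℕ} (G : Graph n) where

  cubicVertices : List (Fin n)
  cubicVertices = filter (λ u → degree G u ≟ 3) (allFin n)

  ∈-cubicVertices⁺ : ∀ {u} → degree G u ≡ 3 → u ∈ cubicVertices
  ∈-cubicVertices⁺ {u} = ∈-filter⁺ (λ u → degree G u ≟ 3) (∈-allFin u)

  ∈-cubicVertices⁻ : ∀ {u} → u ∈ cubicVertices → degree G u ≡ 3
  ∈-cubicVertices⁻ = proj₂ ∘ ∈-filter⁻ (λ u → degree G u ≟ 3) {xs = allFin n}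

  cubicVertices-unique : Unique cubicVertices
  cubicVertices-unique = filter⁺ _ (allFin⁺ n)

  degree-sum-Deg₂₃ : (∀ u → Deg₂₃ (degree G u)) → ∑[ i < n ] degree G i ≡ 2 * n + length cubicVertices
  degree-sum-Deg₂₃ deg = begin
    ∑[ i < n ] degree G i
      ≡⟨ sum-cong-≗ (λ i → split (deg i)) ⟩
    ∑[ i < n ] (2 + 1 when does (degree G i ≟ 3))
      ≡⟨ ∑-distrib-+ (const 2) (λ i → 1 when does (degree G i ≟ 3)) ⟩
    ∑[ i < n ] 2 + ∑[ i < n ] (1 when does (degree G i ≟ 3))
      ≡⟨ cong₂ _+_ (trans (∑-const n 2) (*-comm n 2)) (sym (sum-map-tabulate (λ i → 1 when does (degree G i ≟ 3)) (λ i → i))) ⟩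
    2 * n + sum (map (λ i → 1 when does (degree G i ≟ 3)) (allFin n))
      ≡⟨ cong (2 * n +_) (length-filter≡sum-map-when (λ u → degree G u ≟ 3) (allFin n)) ⟨
    2 * n + length cubicVertices ∎
    where
      open ≡-Reasoning
      split : ∀ {d} → Deg₂₃ d → d ≡ 2 + 1 when does (d ≟ 3)
      split deg2 = refl
      split deg3 = refl

  CrossPair : Fin n × Fin n → Set
  CrossPair (u , v) = G u v ≡ true × degree G u ≡ 3 × degree G v ≡ 2

  crossPair? : Decidable CrossPair
  crossPair? (u , v) = G u v Bool.≟ true ×-dec degree G u ≟ 3 ×-dec degree G v ≟ 2

  crossPairs : List (Fin n × Fin n)
  crossPairs = filter crossPair? (cartesianProduct (allFin n) (allFin n))

  ∈-crossPairs⁺ : ∀ {e} → CrossPair e → e ∈ crossPairs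
  ∈-crossPairs⁺ {u , v} = ∈-filter⁺ crossPair? (∈-cartesianProduct⁺ (∈-allFin u) (∈-allFin v))

  ∈-crossPairs⁻ : ∀ {e} → e ∈ crossPairs → CrossPair e
  ∈-crossPairs⁻ = proj₂ ∘ ∈-filter⁻ crossPair? {xs = cartesianProduct (allFin n) (allFin n)}

  crossPairs-unique : Unique crossPairs
  crossPairs-unique = filter⁺ _ (cartesianProduct⁺ (allFin⁺ n) (allFin⁺ n))

  length-crossPairs : length crossPairs ≡ ∑[ i < n ] ∑[ j < n ] (1 when does (crossPair? (i , j)))
  length-crossPairs = begin
    length crossPairs
      ≡⟨ length-filter≡sum-map-when crossPair? (cartesianProduct (allFin n) (allFin n)) ⟩
    sum (map (λ e → 1 when does (crossPair? e)) (cartesianProduct (allFin n) (allFin n)))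
      ≡⟨ sum-map-cartesianProduct (λ e → 1 when does (crossPair? e)) (λ i → i) (allFin n) ⟩
    ∑[ i < n ] sum (map (λ j → 1 when does (crossPair? (i , j))) (allFin n))
      ≡⟨ sum-cong-≗ (λ i → sum-map-tabulate (λ j → 1 when does (crossPair? (i , j))) (λ j → j)) ⟩
    ∑[ i < n ] ∑[ j < n ] (1 when does (crossPair? (i , j))) ∎
    where open ≡-Reasoning

  totalGap≡crossPairs : Simple G → (∀ u → Deg₂₃ (degree G u)) → ∀ bound c →
    (∀ {a b} → Deg₂₃ a → Deg₂₃ b → gap bound a b ≡ c * (1 when crosses a b) + c * (1 when crosses b a)) →
    totalGap G bound ≡ c * length crossPairs
  totalGap≡crossPairs simple deg bound c gap-formula = begin
    totalGap G bound
      ≡⟨ cong sum (map-cong (λ e → gap-formula (deg (proj₁ e)) (deg (proj₂ e))) (edges G)) ⟩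
    sum (map (λ e → F (proj₁ e) (proj₂ e) + F (proj₂ e) (proj₁ e)) (edges G))
      ≡⟨ sum-edges-sym G simple F ⟩
    ∑[ i < n ] ∑[ j < n ] (F i j when G i j)
      ≡⟨ sum-cong-≗ (λ i → sum-cong-≗ (λ j → when-∧ (G i j) (crosses (d i) (d j)))) ⟩
    ∑[ i < n ] ∑[ j < n ] (c * (1 when does (crossPair? (i , j))))
      ≡⟨ sum-cong-≗ (λ i → *-distribˡ-sum c (λ j → 1 when does (crossPair? (i , j)))) ⟨
    ∑[ i < n ] (c * ∑[ j < n ] (1 when does (crossPair? (i , j))))
      ≡⟨ *-distribˡ-sum c (λ i → ∑[ j < n ] (1 when does (crossPair? (i , j)))) ⟨
    c * ∑[ i < n ] ∑[ j < n ] (1 when does (crossPair? (i , j)))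
      ≡⟨ cong (c *_) length-crossPairs ⟨
    c * length crossPairs ∎
    where
      open ≡-Reasoning
      d : Fin n → ℕ
      d = degree G
      F : Fin n → Fin n → ℕ
      F i j = c * (1 when crosses (d i) (d j))
      when-∧ : ∀ g b → (c * (1 when b)) when g ≡ c * (1 when (does (g Bool.≟ true) ∧ b))
      when-∧ true  b = refl
      when-∧ false b = sym (*-zeroʳ c)

module CubicComplement {n : ℕ} (G : Graph n) (simple : Simple G) (deg : ∀ x → Deg₂₃ (degree G x))
  (four : length (cubicVertices G) ≡ 4) where

  open DecMembership (Fin._≟_ {n}) using (_∈?_)

  cubic-complement : List (Fin n) → List (Fin n)
  cubic-complement xs = filter (λ y → ¬? (y ∈? xs)) (cubicVertices G)

  ∈-cubic-complement⁺ : ∀ {xs y} → degree G y ≡ 3 → y ∉ xs → y ∈ cubic-complement xs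
  ∈-cubic-complement⁺ {xs} dy y∉xs = ∈-filter⁺ (λ y → ¬? (y ∈? xs)) (∈-cubicVertices⁺ G dy) y∉xs

  ∈-cubic-complement⁻ : ∀ {xs y} → y ∈ cubic-complement xs → degree G y ≡ 3 × y ∉ xs
  ∈-cubic-complement⁻ {xs} = Product.map₁ (∈-cubicVertices⁻ G) ∘ ∈-filter⁻ (λ y → ¬? (y ∈? xs)) {xs = cubicVertices G}

  cubic-complement-unique : ∀ xs → Unique (cubic-complement xs)
  cubic-complement-unique xs = filter⁺ _ (cubicVertices-unique G)

  length-cubic-complement : ∀ {xs} → Unique xs → All (λ x → degree G x ≡ 3) xs → length xs + length (cubic-complement xs) ≡ 4
  length-cubic-complement {xs} uxs cubic = trans (sym (length-++ xs)) (≤-antisym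
    (subst (length (xs ++ cubic-complement xs) ≤_) four (length-mono-⊆ (++⁺ uxs (cubic-complement-unique xs) disjoint) ⊆cubic))
    (subst (_≤ length (xs ++ cubic-complement xs)) four (length-mono-⊆ (cubicVertices-unique G) cubic⊆)))
    where
      disjoint : ∀ {y} → ¬ (y ∈ xs × y ∈ cubic-complement xs)
      disjoint (y∈xs , y∈c) = proj₂ (∈-cubic-complement⁻ y∈c) y∈xs
      ⊆cubic : xs ++ cubic-complement xs ⊆ cubicVertices G
      ⊆cubic y∈ with ∈-++⁻ xs y∈
      ... | inj₁ y∈xs = ∈-cubicVertices⁺ G (All.lookup cubic y∈xs)
      ... | inj₂ y∈c  = ∈-cubicVertices⁺ G (proj₁ (∈-cubic-complement⁻ y∈c))
      cubic⊆ : cubicVertices G ⊆ xs ++ cubic-complement xs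
      cubic⊆ {y} y∈ with y ∈? xs
      ... | yes y∈xs = ∈-++⁺ˡ y∈xs
      ... | no y∉xs  = ∈-++⁺ʳ xs (∈-cubic-complement⁺ (∈-cubicVertices⁻ G y∈) y∉xs)

  cubic-without-crossPairs-adjacent : ∀ {x y} → degree G x ≡ 3 → (∀ {w} → ¬ CrossPair G (x , w)) →
    degree G y ≡ 3 → x ≢ y → G x y ≡ true
  cubic-without-crossPairs-adjacent {x} {y} dx no-cross dy x≢y =
    All.lookup (nbrs-saturate G cover (≤-reflexive (trans (+-cancelˡ-≡ 1 _ _ (length-cubic-complement ([] ∷ []) (dx ∷ []))) (sym dx))))
      (∈-cubic-complement⁺ dy λ { (here y≡x) → x≢y (sym y≡x) })
    where
      cover : ∀ {w} → G x w ≡ true → w ∈ cubic-complement (x ∷ [])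
      cover {w} xw with degree G w ≟ 3
      ... | yes dw    = ∈-cubic-complement⁺ dw λ { (here w≡x) → adjacent⇒≢ G simple xw (sym w≡x) }
      ... | no dw≢3   = contradiction (xw , dx , Deg₂₃-≢3 (deg w) dw≢3) no-cross

-- The graph T_n

module Tₙ (m : ℕ) where

  n b u v : ℕ
  n = 5 + m
  b = 2 + m
  u = 3 + m
  v = 4 + m

  data TEdge : ℕ → ℕ → Set where
    path : ∀ {x} → suc x ≤ b → TEdge x (suc x)
    uv   : TEdge u v
    au   : TEdge 0 u
    av   : TEdge 0 v
    bu   : TEdge b u
    bv   : TEdge b v

  private
    pathᵇ uvᵇ aᵇ bᵇ : ℕ → ℕ → Bool
    pathᵇ x y = (suc x ≡ᵇ y) ∧ (y <ᵇ u)
    uvᵇ x y = (x ≡ᵇ u) ∧ (y ≡ᵇ v)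
    aᵇ x y = (x ≡ᵇ 0) ∧ ((y ≡ᵇ u) ∨ (y ≡ᵇ v))
    bᵇ x y = (x ≡ᵇ b) ∧ ((y ≡ᵇ u) ∨ (y ≡ᵇ v))

    ∨⁻ : ∀ p {q} → IsTrue (p ∨ q) → IsTrue p ⊎ IsTrue q
    ∨⁻ p = Equivalence.to (T-∨ {p})

    ∨⁺ˡ : ∀ p q → IsTrue p → IsTrue (p ∨ q)
    ∨⁺ˡ p q = Equivalence.from (T-∨ {p} {q}) ∘ inj₁

    ∨⁺ʳ : ∀ p q → IsTrue q → IsTrue (p ∨ q)
    ∨⁺ʳ p q = Equivalence.from (T-∨ {p} {q}) ∘ inj₂

    ∧⁻ : ∀ p {q} → IsTrue (p ∧ q) → IsTrue p × IsTrue q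
    ∧⁻ p = Equivalence.to (T-∧ {p})

    ∧⁺ : ∀ p q → IsTrue p → IsTrue q → IsTrue (p ∧ q)
    ∧⁺ p q tp tq = Equivalence.from (T-∧ {p} {q}) (tp , tq)

    ≡ᵇ-refl : ∀ k → IsTrue (k ≡ᵇ k)
    ≡ᵇ-refl k = ≡⇒≡ᵇ k k refl

    in-a : ∀ {x y} → IsTrue (aᵇ x y) → IsTrue (edgeT n x y)
    in-a {x} {y} = ∨⁺ʳ (pathᵇ x y) _ ∘ ∨⁺ʳ (uvᵇ x y) _ ∘ ∨⁺ˡ (aᵇ x y) _

    in-b : ∀ {x y} → IsTrue (bᵇ x y) → IsTrue (edgeT n x y)
    in-b {x} {y} = ∨⁺ʳ (pathᵇ x y) _ ∘ ∨⁺ʳ (uvᵇ x y) _ ∘ ∨⁺ʳ (aᵇ x y) _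

    to-apex : ∀ {x} y → TEdge x u → TEdge x v → IsTrue ((y ≡ᵇ u) ∨ (y ≡ᵇ v)) → TEdge x y
    to-apex y xu xv t with ∨⁻ (y ≡ᵇ u) t
    ... | inj₁ y≡u rewrite ≡ᵇ⇒≡ y u y≡u = xu
    ... | inj₂ y≡v rewrite ≡ᵇ⇒≡ y v y≡v = xv

    path-sound : ∀ x y → IsTrue (pathᵇ x y) → TEdge x y
    path-sound x y t with ∧⁻ (suc x ≡ᵇ y) t
    ... | sx≡y , y<u rewrite sym (≡ᵇ⇒≡ (suc x) y sx≡y) = path (≤-pred (<ᵇ⇒< (suc x) u y<u))

    uv-sound : ∀ x y → IsTrue (uvᵇ x y) → TEdge x y
    uv-sound x y t with ∧⁻ (x ≡ᵇ u) t
    ... | x≡u , y≡v rewrite ≡ᵇ⇒≡ x u x≡u | ≡ᵇ⇒≡ y v y≡v = uv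

    a-sound : ∀ x y → IsTrue (aᵇ x y) → TEdge x y
    a-sound x y t with ∧⁻ (x ≡ᵇ 0) t
    ... | x≡0 , t-apex rewrite ≡ᵇ⇒≡ x 0 x≡0 = to-apex y au av t-apex

    b-sound : ∀ x y → IsTrue (bᵇ x y) → TEdge x y
    b-sound x y t with ∧⁻ (x ≡ᵇ b) t
    ... | x≡b , t-apex rewrite ≡ᵇ⇒≡ x b x≡b = to-apex y bu bv t-apex

  edgeT-sound : ∀ x y → IsTrue (edgeT n x y) → TEdge x y
  edgeT-sound x y =
    [ path-sound x y , [ uv-sound x y , [ a-sound x y , b-sound x y ]′ ∘ ∨⁻ (aᵇ x y) ]′ ∘ ∨⁻ (uvᵇ x y) ]′ ∘ ∨⁻ (pathᵇ x y)

  edgeT-complete : ∀ {x y} → TEdge x y → IsTrue (edgeT n x y)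
  edgeT-complete {x} {y} (path sx≤b) = ∨⁺ˡ (pathᵇ x y) _ (∧⁺ (y ≡ᵇ y) _ (≡ᵇ-refl y) (<⇒<ᵇ (s≤s sx≤b)))
  edgeT-complete {x} {y} uv = ∨⁺ʳ (pathᵇ x y) _ (∨⁺ˡ (uvᵇ x y) _ (∧⁺ (x ≡ᵇ u) _ (≡ᵇ-refl u) (≡ᵇ-refl v)))
  edgeT-complete {x} {y} au = in-a {x} {y} (∧⁺ (x ≡ᵇ 0) _ (≡ᵇ-refl 0) (∨⁺ˡ (y ≡ᵇ u) _ (≡ᵇ-refl u)))
  edgeT-complete {x} {y} av = in-a {x} {y} (∧⁺ (x ≡ᵇ 0) _ (≡ᵇ-refl 0) (∨⁺ʳ (y ≡ᵇ u) _ (≡ᵇ-refl v)))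
  edgeT-complete {x} {y} bu = in-b {x} {y} (∧⁺ (x ≡ᵇ b) _ (≡ᵇ-refl b) (∨⁺ˡ (y ≡ᵇ u) _ (≡ᵇ-refl u)))
  edgeT-complete {x} {y} bv = in-b {x} {y} (∧⁺ (x ≡ᵇ b) _ (≡ᵇ-refl b) (∨⁺ʳ (y ≡ᵇ u) _ (≡ᵇ-refl v)))

  TAdj : ℕ → ℕ → Set
  TAdj x y = TEdge x y ⊎ TEdge y x

  T⇔TAdj : ∀ i j → T n i j ≡ true ⇔ TAdj (toℕ i) (toℕ j)
  T⇔TAdj i j = mk⇔
    (Sum.map (edgeT-sound (toℕ i) (toℕ j)) (edgeT-sound (toℕ j) (toℕ i)) ∘ ∨⁻ (edgeT n (toℕ i) (toℕ j)) ∘ Equivalence.from T-≡)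
    (Equivalence.to T-≡ ∘ [ ∨⁺ˡ _ _ ∘ edgeT-complete , ∨⁺ʳ (edgeT n (toℕ i) (toℕ j)) _ ∘ edgeT-complete ]′)

  TEdge-irreflexive : ∀ {x} → ¬ TEdge x x
  TEdge-irreflexive ()

  data Kind : ℕ → Set where
    end-a  : Kind 0
    mid    : ∀ {i} → i ≤ m → Kind (suc i)
    end-b  : Kind b
    apex-u : Kind u
    apex-v : Kind v

  kind : ∀ {x} → x < n → Kind x
  kind {zero} _ = end-a
  kind {suc i} 1+i<n with m≤n⇒m<n∨m≡n (≤-pred (≤-pred 1+i<n))
  ... | inj₂ refl = apex-v
  ... | inj₁ (s≤s i≤2+m) with m≤n⇒m<n∨m≡n i≤2+m
  ...   | inj₂ refl = apex-u
  ...   | inj₁ (s≤s i≤1+m) with m≤n⇒m<n∨m≡n i≤1+m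
  ...     | inj₂ refl = end-b
  ...     | inj₁ (s≤s i≤m) = mid i≤m

  nbrsT : ∀ {x} → Kind x → List ℕ
  nbrsT end-a       = 1 ∷ u ∷ v ∷ []
  nbrsT (mid {i} _) = i ∷ suc (suc i) ∷ []
  nbrsT end-b       = suc m ∷ u ∷ v ∷ []
  nbrsT apex-u      = 0 ∷ b ∷ v ∷ []
  nbrsT apex-v      = 0 ∷ b ∷ u ∷ []

  private
    ≰-suc+ : ∀ k {x} → ¬ (suc (k + x) ≤ x)
    ≰-suc+ k {x} le = 1+n≰n (≤-trans (s≤s (m≤n+m x k)) le)

  TAdj⇒∈nbrsT : ∀ {x y} (k : Kind x) → TAdj x y → y ∈ nbrsT k
  TAdj⇒∈nbrsT end-a        (inj₁ (path _))  = here refl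
  TAdj⇒∈nbrsT end-a        (inj₁ au)        = there (here refl)
  TAdj⇒∈nbrsT end-a        (inj₁ av)        = there (there (here refl))
  TAdj⇒∈nbrsT (mid _)      (inj₁ (path _))  = there (here refl)
  TAdj⇒∈nbrsT (mid i≤m)    (inj₁ uv)        = contradiction i≤m (≰-suc+ 1)
  TAdj⇒∈nbrsT (mid i≤m)    (inj₁ bu)        = contradiction i≤m (≰-suc+ 0)
  TAdj⇒∈nbrsT (mid i≤m)    (inj₁ bv)        = contradiction i≤m (≰-suc+ 0)
  TAdj⇒∈nbrsT (mid _)      (inj₂ (path _))  = here refl
  TAdj⇒∈nbrsT (mid i≤m)    (inj₂ uv)        = contradiction i≤m (≰-suc+ 2)
  TAdj⇒∈nbrsT (mid i≤m)    (inj₂ au)        = contradiction i≤m (≰-suc+ 1)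
  TAdj⇒∈nbrsT (mid i≤m)    (inj₂ av)        = contradiction i≤m (≰-suc+ 2)
  TAdj⇒∈nbrsT (mid i≤m)    (inj₂ bu)        = contradiction i≤m (≰-suc+ 1)
  TAdj⇒∈nbrsT (mid i≤m)    (inj₂ bv)        = contradiction i≤m (≰-suc+ 2)
  TAdj⇒∈nbrsT end-b        (inj₁ (path le)) = contradiction le (≰-suc+ 0)
  TAdj⇒∈nbrsT end-b        (inj₁ bu)        = there (here refl)
  TAdj⇒∈nbrsT end-b        (inj₁ bv)        = there (there (here refl))
  TAdj⇒∈nbrsT end-b        (inj₂ (path _))  = here refl
  TAdj⇒∈nbrsT apex-u       (inj₁ (path le)) = contradiction le (≰-suc+ 1)
  TAdj⇒∈nbrsT apex-u       (inj₁ uv)        = there (there (here refl))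
  TAdj⇒∈nbrsT apex-u       (inj₂ (path le)) = contradiction le (≰-suc+ 0)
  TAdj⇒∈nbrsT apex-u       (inj₂ au)        = here refl
  TAdj⇒∈nbrsT apex-u       (inj₂ bu)        = there (here refl)
  TAdj⇒∈nbrsT apex-v       (inj₁ (path le)) = contradiction le (≰-suc+ 2)
  TAdj⇒∈nbrsT apex-v       (inj₂ (path le)) = contradiction le (≰-suc+ 1)
  TAdj⇒∈nbrsT apex-v       (inj₂ uv)        = there (there (here refl))
  TAdj⇒∈nbrsT apex-v       (inj₂ av)        = here refl
  TAdj⇒∈nbrsT apex-v       (inj₂ bv)        = there (here refl)

  ∈nbrsT⇒TAdj : ∀ {x y} (k : Kind x) → y ∈ nbrsT k → TAdj x y
  ∈nbrsT⇒TAdj end-a     (here refl)                 = inj₁ (path (s≤s z≤n))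
  ∈nbrsT⇒TAdj end-a     (there (here refl))         = inj₁ au
  ∈nbrsT⇒TAdj end-a     (there (there (here refl))) = inj₁ av
  ∈nbrsT⇒TAdj (mid i≤m) (here refl)                 = inj₂ (path (s≤s (m≤n⇒m≤1+n i≤m)))
  ∈nbrsT⇒TAdj (mid i≤m) (there (here refl))         = inj₁ (path (s≤s (s≤s i≤m)))
  ∈nbrsT⇒TAdj end-b     (here refl)                 = inj₂ (path ≤-refl)
  ∈nbrsT⇒TAdj end-b     (there (here refl))         = inj₁ bu
  ∈nbrsT⇒TAdj end-b     (there (there (here refl))) = inj₁ bv
  ∈nbrsT⇒TAdj apex-u    (here refl)                 = inj₂ au
  ∈nbrsT⇒TAdj apex-u    (there (here refl))         = inj₂ bu
  ∈nbrsT⇒TAdj apex-u    (there (there (here refl))) = inj₁ uv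
  ∈nbrsT⇒TAdj apex-v    (here refl)                 = inj₂ av
  ∈nbrsT⇒TAdj apex-v    (there (here refl))         = inj₂ bv
  ∈nbrsT⇒TAdj apex-v    (there (there (here refl))) = inj₂ uv

  Kind⇒< : ∀ {x} → Kind x → x < n
  Kind⇒< end-a     = s≤s z≤n
  Kind⇒< (mid i≤m) = s≤s (s≤s (≤-trans i≤m (m≤n+m m 3)))
  Kind⇒< end-b     = s≤s (s≤s (s≤s (m≤n+m m 2)))
  Kind⇒< apex-u    = s≤s (s≤s (s≤s (s≤s (m≤n+m m 1))))
  Kind⇒< apex-v    = ≤-refl

  nbrsT-< : ∀ {x} (k : Kind x) → All (_< n) (nbrsT k)
  nbrsT-< k = All.tabulate (λ y∈ → s≤s ([ proj₂ ∘ TEdge-≤v , proj₁ ∘ TEdge-≤v ]′ (∈nbrsT⇒TAdj k y∈)))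
    where
      b≤v : b ≤ v
      b≤v = m≤n+m b 2
      TEdge-≤v : ∀ {x y} → TEdge x y → x ≤ v × y ≤ v
      TEdge-≤v (path sx≤b) = ≤-trans (n≤1+n _) (≤-trans sx≤b b≤v) , ≤-trans sx≤b b≤v
      TEdge-≤v uv = n≤1+n u , ≤-refl
      TEdge-≤v au = z≤n , n≤1+n u
      TEdge-≤v av = z≤n , ≤-refl
      TEdge-≤v bu = b≤v , n≤1+n u
      TEdge-≤v bv = b≤v , ≤-refl

  nbrsT-unique : ∀ {x} (k : Kind x) → Unique (nbrsT k)
  nbrsT-unique end-a   = ((λ ()) ∷ (λ ()) ∷ []) ∷ ((λ ()) ∷ []) ∷ [] ∷ []
  nbrsT-unique (mid _) = ((λ ()) ∷ []) ∷ [] ∷ []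
  nbrsT-unique end-b   = ((λ ()) ∷ (λ ()) ∷ []) ∷ ((λ ()) ∷ []) ∷ [] ∷ []
  nbrsT-unique apex-u  = ((λ ()) ∷ (λ ()) ∷ []) ∷ ((λ ()) ∷ []) ∷ [] ∷ []
  nbrsT-unique apex-v  = ((λ ()) ∷ (λ ()) ∷ []) ∷ ((λ ()) ∷ []) ∷ [] ∷ []

  kind-of : (i : Fin n) → Kind (toℕ i)
  kind-of i = kind (toℕ<n i)

  vertex : ∀ {x} → Kind x → Fin n
  vertex k = fromℕ< (Kind⇒< k)

  toℕ-vertex : ∀ {x} (k : Kind x) → toℕ (vertex k) ≡ x
  toℕ-vertex k = toℕ-fromℕ< (Kind⇒< k)

  T-adj : ∀ {i j x y} → toℕ i ≡ x → toℕ j ≡ y → TAdj x y → T n i j ≡ true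
  T-adj {i} {j} refl refl = Equivalence.from (T⇔TAdj i j)

  T-simple : Simple (T n)
  T-simple = (λ i j → ∨-comm (edgeT n (toℕ i) (toℕ j)) _) , irreflexive
    where
      irreflexive : ∀ i → T n i i ≡ false
      irreflexive i with T n i i in ii
      ... | true  = contradiction (Equivalence.to (T⇔TAdj i i) ii) [ TEdge-irreflexive , TEdge-irreflexive ]′
      ... | false = refl

  degree-T : ∀ i {x} → toℕ i ≡ x → (k : Kind x) → degree (T n) i ≡ length (nbrsT k)
  degree-T i refl k = trans (degree≡length-nbrs (T n) i)
    (length-≡-by-injection toℕ toℕ-injective (nbrs-unique (T n) i) (nbrsT-unique k) into onto)
    where
      into : ∀ {j} → j ∈ nbrs (T n) i → toℕ j ∈ nbrsT k
      into j∈ = TAdj⇒∈nbrsT k (Equivalence.to (T⇔TAdj i _) (∈-nbrs⁻ (T n) j∈))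
      onto : ∀ {y} → y ∈ nbrsT k → ∃ λ j → j ∈ nbrs (T n) i × toℕ j ≡ y
      onto y∈ = let y<n = All.lookup (nbrsT-< k) y∈ in
        fromℕ< y<n , ∈-nbrs⁺ (T n) (T-adj refl (toℕ-fromℕ< y<n) (∈nbrsT⇒TAdj k y∈)) , toℕ-fromℕ< y<n

  T-Deg₂₃ : ∀ i → Deg₂₃ (degree (T n) i)
  T-Deg₂₃ i = by-kind (kind-of i) refl
    where
      by-kind : ∀ {x} → Kind x → toℕ i ≡ x → Deg₂₃ (degree (T n) i)
      by-kind k@end-a   eq = subst Deg₂₃ (sym (degree-T i eq k)) deg3
      by-kind k@(mid _) eq = subst Deg₂₃ (sym (degree-T i eq k)) deg2
      by-kind k@end-b   eq = subst Deg₂₃ (sym (degree-T i eq k)) deg3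
      by-kind k@apex-u  eq = subst Deg₂₃ (sym (degree-T i eq k)) deg3
      by-kind k@apex-v  eq = subst Deg₂₃ (sym (degree-T i eq k)) deg3

  T-cubicVertices : length (cubicVertices (T n)) ≡ 4
  T-cubicVertices = length-≡-by-injection toℕ toℕ-injective {ys = 0 ∷ b ∷ u ∷ v ∷ []}
    (cubicVertices-unique (T n)) (((λ ()) ∷ (λ ()) ∷ (λ ()) ∷ []) ∷ ((λ ()) ∷ (λ ()) ∷ []) ∷ ((λ ()) ∷ []) ∷ [] ∷ [])
    (λ {i} i∈ → into (kind-of i) refl (∈-cubicVertices⁻ (T n) i∈)) onto
    where
      into : ∀ {i x} → Kind x → toℕ i ≡ x → degree (T n) i ≡ 3 → toℕ i ∈ 0 ∷ b ∷ u ∷ v ∷ []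
      into end-a         eq _   = here eq
      into {i} (mid i≤m) eq d≡3 = contradiction (trans (sym (degree-T i eq (mid i≤m))) d≡3) λ ()
      into end-b         eq _   = there (here eq)
      into apex-u        eq _   = there (there (here eq))
      into apex-v        eq _   = there (there (there (here eq)))
      cubic : ∀ {x} (k : Kind x) → length (nbrsT k) ≡ 3 → ∃ λ i → i ∈ cubicVertices (T n) × toℕ i ≡ x
      cubic k len = vertex k , ∈-cubicVertices⁺ (T n) (trans (degree-T (vertex k) (toℕ-vertex k) k) len) , toℕ-vertex k
      onto : ∀ {y} → y ∈ 0 ∷ b ∷ u ∷ v ∷ [] → ∃ λ i → i ∈ cubicVertices (T n) × toℕ i ≡ y
      onto (here refl)                         = cubic end-a refl
      onto (there (here refl))                 = cubic end-b refl
      onto (there (there (here refl)))         = cubic apex-u refl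
      onto (there (there (there (here refl)))) = cubic apex-v refl

  T-edgeCount : edgeCount (T n) ≡ n + 2
  T-edgeCount = *-cancelˡ-≡ (edgeCount (T n)) (n + 2) 2 (begin
    2 * edgeCount (T n)                  ≡⟨ handshake (T n) T-simple ⟩
    ∑[ i < n ] degree (T n) i            ≡⟨ degree-sum-Deg₂₃ (T n) T-Deg₂₃ ⟩
    2 * n + length (cubicVertices (T n)) ≡⟨ cong (2 * n +_) T-cubicVertices ⟩
    2 * n + 2 * 2                        ≡⟨ *-distribˡ-+ 2 n 2 ⟨
    2 * (n + 2)                          ∎)
    where open ≡-Reasoning

  T-connected : Connected (T n)
  T-connected = connected-via-root (proj₁ T-simple) Fin.zero (λ i → to-a (kind-of i) refl)
    where
      along-path : ∀ x → x ≤ b → ∀ {i} → toℕ i ≡ x → Walk (T n) i Fin.zero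
      along-path zero _ {i} eq = subst (λ j → Walk (T n) j Fin.zero) (sym (toℕ-injective eq)) here
      along-path (suc x) sx≤b eq =
        step (T-adj eq (toℕ-fromℕ< x<n) (inj₂ (path sx≤b))) (along-path x (≤-trans (n≤1+n x) sx≤b) (toℕ-fromℕ< x<n))
        where
          x<n : x < n
          x<n = ≤-trans sx≤b (m≤n+m b 3)
      to-a : ∀ {i x} → Kind x → toℕ i ≡ x → Walk (T n) i Fin.zero
      to-a end-a     eq = along-path 0 z≤n eq
      to-a (mid i≤m) eq = along-path _ (s≤s (m≤n⇒m≤1+n i≤m)) eq
      to-a end-b     eq = along-path b ≤-refl eq
      to-a apex-u    eq = step (T-adj eq refl (inj₂ au)) here
      to-a apex-v    eq = step (T-adj eq refl (inj₂ av)) here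

  private
    crossPair-labels : ∀ {i j} → CrossPair (T n) (i , j) → (toℕ i , toℕ j) ∈ (0 , 1) ∷ (b , suc m) ∷ []
    crossPair-labels {i} {j} (ij , di , dj) = from-kind (kind-of i) refl
      where
        not-cubic : ∀ {y} → toℕ j ≡ y → (k : Kind y) → length (nbrsT k) ≡ 3 → ⊥
        not-cubic eq k len = contradiction (trans (sym dj) (trans (degree-T j eq k) len)) λ ()
        from-kind : ∀ {x} → Kind x → toℕ i ≡ x → (toℕ i , toℕ j) ∈ (0 , 1) ∷ (b , suc m) ∷ []
        from-kind {x} k eq with TAdj⇒∈nbrsT k (subst (λ x → TAdj x (toℕ j)) eq (Equivalence.to (T⇔TAdj i j) ij))
        from-kind end-a     eq | here j≡1                 = here (cong₂ _,_ eq j≡1)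
        from-kind end-a     eq | there (here j≡u)         = ⊥-elim (not-cubic j≡u apex-u refl)
        from-kind end-a     eq | there (there (here j≡v)) = ⊥-elim (not-cubic j≡v apex-v refl)
        from-kind (mid i≤m) eq | _                        = contradiction (trans (sym di) (degree-T i eq (mid i≤m))) λ ()
        from-kind end-b     eq | here j≡1+m               = there (here (cong₂ _,_ eq j≡1+m))
        from-kind end-b     eq | there (here j≡u)         = ⊥-elim (not-cubic j≡u apex-u refl)
        from-kind end-b     eq | there (there (here j≡v)) = ⊥-elim (not-cubic j≡v apex-v refl)
        from-kind apex-u    eq | here j≡0                 = ⊥-elim (not-cubic j≡0 end-a refl)
        from-kind apex-u    eq | there (here j≡b)         = ⊥-elim (not-cubic j≡b end-b refl)
        from-kind apex-u    eq | there (there (here j≡v)) = ⊥-elim (not-cubic j≡v apex-v refl)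
        from-kind apex-v    eq | here j≡0                 = ⊥-elim (not-cubic j≡0 end-a refl)
        from-kind apex-v    eq | there (here j≡b)         = ⊥-elim (not-cubic j≡b end-b refl)
        from-kind apex-v    eq | there (there (here j≡u)) = ⊥-elim (not-cubic j≡u apex-u refl)

    crossPair-at : ∀ {x y} (k : Kind x) (l : Kind y) → TAdj x y → length (nbrsT k) ≡ 3 → length (nbrsT l) ≡ 2 →
      ∃ λ e → e ∈ crossPairs (T n) × Product.map toℕ toℕ e ≡ (x , y)
    crossPair-at k l adj deg-k deg-l =
      (vertex k , vertex l) ,
      ∈-crossPairs⁺ (T n) (T-adj (toℕ-vertex k) (toℕ-vertex l) adj ,
                          trans (degree-T (vertex k) (toℕ-vertex k) k) deg-k ,
                          trans (degree-T (vertex l) (toℕ-vertex l) l) deg-l) ,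
      cong₂ _,_ (toℕ-vertex k) (toℕ-vertex l)

  T-crossPairs : length (crossPairs (T n)) ≡ 2
  T-crossPairs = length-≡-by-injection (Product.map toℕ toℕ) toℕ²-injective {ys = (0 , 1) ∷ (b , suc m) ∷ []}
    (crossPairs-unique (T n)) (((λ ()) ∷ []) ∷ [] ∷ []) (crossPair-labels ∘ ∈-crossPairs⁻ (T n)) onto
    where
      toℕ²-injective : ∀ {e f : Fin n × Fin n} → Product.map toℕ toℕ e ≡ Product.map toℕ toℕ f → e ≡ f
      toℕ²-injective eq = cong₂ _,_ (toℕ-injective (,-injectiveˡ eq)) (toℕ-injective (,-injectiveʳ eq))
      onto : ∀ {y} → y ∈ (0 , 1) ∷ (b , suc m) ∷ [] → ∃ λ e → e ∈ crossPairs (T n) × Product.map toℕ toℕ e ≡ y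
      onto (here refl)         = crossPair-at end-a (mid z≤n) (inj₁ (path (s≤s z≤n))) refl refl
      onto (there (here refl)) = crossPair-at end-b (mid ≤-refl) (inj₂ (path ≤-refl)) refl refl

  T-totalGap : totalGap (T n) lower720 ≡ 14
  T-totalGap = trans (totalGap≡crossPairs (T n) T-simple T-Deg₂₃ lower720 7 gap-lower720) (cong (7 *_) T-crossPairs)

  T-InG3 : InG3 n (n + 2) (T n)
  T-InG3 = T-simple , T-connected , T-edgeCount , λ i → Deg≤3 (T-Deg₂₃ i)
    where
      Deg≤3 : ∀ {d} → Deg₂₃ d → d ≤ 3
      Deg≤3 deg2 = ≤ᵇ⇒≤ 2 3 _
      Deg≤3 deg3 = ≤-refl


-- Trails through vertices of degree 2

module DegreeTwoTrail {n : ℕ} (G : Graph n) (simple : Simple G) (deg : ∀ x → Deg₂₃ (degree G x))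
  (a s : Fin n) (as : G a s ≡ true) (deg-a : degree G a ≡ 3) (deg-s : degree G s ≡ 2) where

  opaque
    other-nbr : ∀ prev cur → ∃ λ w → G cur w ≡ true × w ≢ prev
    other-nbr prev cur with any? (λ w → G cur w Bool.≟ true ×-dec ¬? (w Fin.≟ prev))
    ... | yes found = found
    ... | no none = contradiction (≤-trans (Deg₂₃⇒2≤ (deg cur)) (degree-≤ G only-prev)) 1+n≰n
      where
        only-prev : ∀ {w} → G cur w ≡ true → w ∈ prev ∷ []
        only-prev {w} cw with w Fin.≟ prev
        ... | yes w≡prev = here w≡prev
        ... | no w≢prev  = contradiction (w , cw , w≢prev) none

  trail : ℕ → Fin n
  trail 0             = a
  trail 1             = s
  trail (suc (suc k)) = proj₁ (other-nbr (trail k) (trail (suc k)))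

  trail-adj : ∀ k → G (trail k) (trail (suc k)) ≡ true
  trail-adj zero    = as
  trail-adj (suc k) = proj₁ (proj₂ (other-nbr (trail k) (trail (suc k))))

  trail-turns : ∀ k → trail (2 + k) ≢ trail k
  trail-turns k = proj₂ (proj₂ (other-nbr (trail k) (trail (suc k))))

  Inner : ℕ → Set
  Inner k = ∀ {i} → i < k → degree G (trail (suc i)) ≡ 2

  Inner-pred : ∀ {k} → Inner (suc k) → Inner k
  Inner-pred inner i<k = inner (m<n⇒m<1+n i<k)

  nbhd-inner : ∀ {i} → degree G (trail (suc i)) ≡ 2 → Neighbourhood G (trail (suc i)) (trail i ∷ trail (2 + i) ∷ [])
  nbhd-inner {i} d≡2 =
    neighbourhood G ((trail-turns i ∘ sym ∷ []) ∷ [] ∷ [])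
      (adjacent-sym G simple (trail-adj i) ∷ trail-adj (suc i) ∷ []) (≤-reflexive d≡2)

  Distinct : ℕ → Set
  Distinct k = ∀ {i j} → i < j → j < k → trail (suc i) ≢ trail (suc j)

  private
    -- If trail (2 + k) were an earlier inner vertex trail (1 + i), then its neighbour trail (1 + k)
    -- would be one of the two known neighbours trail i, trail (2 + i) of that vertex.
    fresh : ∀ k → Inner (suc k) → Distinct (suc k) → ∀ {i} → i ≤ k → trail (suc i) ≢ trail (2 + k)
    fresh k inner distinct {i} i≤k eq with m≤n⇒m<n∨m≡n i≤k
    ... | inj₂ refl = adjacent⇒≢ G simple (trail-adj (suc k)) eq
    ... | inj₁ i<k = back-step i<k eq (Equivalence.to (nbhd-inner {i} (inner (m≤n⇒m≤1+n i<k))) k~i)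
      where
        k~i : G (trail (suc i)) (trail (suc k)) ≡ true
        k~i = subst (λ x → G x (trail (suc k)) ≡ true) (sym eq) (adjacent-sym G simple (trail-adj (suc k)))
        back-step : ∀ {i} → i < k → trail (suc i) ≡ trail (2 + k) → trail (suc k) ∈ trail i ∷ trail (2 + i) ∷ [] → ⊥
        back-step {zero}  _   _ (here k≡a) = contradiction (trans (sym (inner (n<1+n k))) (trans (cong (degree G) k≡a) deg-a)) λ ()
        back-step {suc i} i<k _ (here k≡i) = distinct (≤-trans (n≤1+n _) i<k) (n<1+n k) (sym k≡i)
        back-step {i}     i<k eq (there (here k≡2+i)) with m≤n⇒m<n∨m≡n i<k
        ... | inj₁ 1+i<k = distinct 1+i<k (n<1+n k) (sym k≡2+i)
        ... | inj₂ refl  = trail-turns k (sym eq)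

  distinct : ∀ k → Inner k → Distinct (suc k)
  distinct zero    _     i<j (s≤s z≤n) = contradiction i<j λ ()
  distinct (suc k) inner i<j j<2+k with m≤n⇒m<n∨m≡n (≤-pred j<2+k)
  ... | inj₁ j<1+k = distinct k (Inner-pred inner) i<j j<1+k
  ... | inj₂ refl  = fresh k inner (distinct k (Inner-pred inner)) (≤-pred i<j)

  distinct⇒injective : ∀ {k} → Distinct k → ∀ {i j} → i < k → j < k → trail (suc i) ≡ trail (suc j) → i ≡ j
  distinct⇒injective dist {i} {j} i<k j<k eq with <-cmp i j
  ... | tri< i<j _ _ = contradiction eq (dist i<j j<k)
  ... | tri≈ _ i≡j _ = i≡j
  ... | tri> _ _ j<i = contradiction (sym eq) (dist j<i i<k)

  private
    extend : ∀ {k} → Inner (suc k) → degree G (trail (2 + k)) ≡ 2 → Inner (2 + k)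
    extend inner d≡2 i<2+k with m≤n⇒m<n∨m≡n (≤-pred i<2+k)
    ... | inj₁ i<1+k = inner i<1+k
    ... | inj₂ refl  = d≡2

    scan : ∀ k → (∃ λ j → Inner (suc j) × degree G (trail (2 + j)) ≡ 3) ⊎ Inner (suc k)
    scan zero = inj₂ λ { (s≤s z≤n) → deg-s }
    scan (suc k) with scan k
    ... | inj₁ found = inj₁ found
    ... | inj₂ inner with degree G (trail (2 + k)) ≟ 3
    ...   | yes d≡3 = inj₁ (k , inner , d≡3)
    ...   | no d≢3  = inj₂ (extend inner (Deg₂₃-≢3 (deg (trail (2 + k))) d≢3))

  -- n + 1 distinct inner vertices cannot fit into n vertices.
  first-cubic : ∃ λ k → Inner (suc k) × degree G (trail (2 + k)) ≡ 3
  first-cubic with scan n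
  ... | inj₁ found = found
  ... | inj₂ inner = contradiction (injective⇒≤ {f = λ i → trail (suc (toℕ i))} injective) 1+n≰n
    where
      injective : ∀ {i j : Fin (suc n)} → trail (suc (toℕ i)) ≡ trail (suc (toℕ j)) → i ≡ j
      injective {i} {j} = toℕ-injective ∘ distinct⇒injective (distinct (suc n) inner) (m<n⇒m<1+n (toℕ<n i)) (m<n⇒m<1+n (toℕ<n j))

-- Graphs with at most two cross pairs are T_n

module Labelling (m : ℕ) (G : Graph (5 + m)) (simple : Simple G) (connected : Connected G)
  (deg : ∀ x → Deg₂₃ (degree G x)) (four : length (cubicVertices G) ≡ 4) (few-cross : length (crossPairs G) ≤ 2)
  (a s : Fin (5 + m)) (as : G a s ≡ true) (deg-a : degree G a ≡ 3) (deg-s : degree G s ≡ 2) (k : ℕ)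
  (inner : DegreeTwoTrail.Inner G simple deg a s as deg-a deg-s (suc k))
  (deg-b : degree G (DegreeTwoTrail.trail G simple deg a s as deg-a deg-s (2 + k)) ≡ 3) where

  open DegreeTwoTrail G simple deg a s as deg-a deg-s
  open CubicComplement G simple deg four

  b p : Fin (5 + m)
  b = trail (2 + k)
  p = trail (suc k)

  private
    adj-sym : ∀ {x y} → G x y ≡ true → G y x ≡ true
    adj-sym = adjacent-sym G simple

    2≢3 : ∀ {x y} → degree G x ≡ 2 → degree G y ≡ 3 → x ≢ y
    2≢3 dx dy refl = contradiction (trans (sym dx) dy) λ ()

    deg-trail : ∀ {i} → i ≤ k → degree G (trail (suc i)) ≡ 2
    deg-trail i≤k = inner (s≤s i≤k)

  no-three-crossPairs : ∀ {e₁ e₂ e₃} → CrossPair G e₁ → CrossPair G e₂ → CrossPair G e₃ →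
    Unique (e₁ ∷ e₂ ∷ e₃ ∷ []) → ⊥
  no-three-crossPairs {e₁} {e₂} {e₃} c₁ c₂ c₃ unique =
    contradiction (≤-trans (length-mono-⊆ unique ⊆crossPairs) few-cross) λ { (s≤s (s≤s ())) }
    where
      ⊆crossPairs : e₁ ∷ e₂ ∷ e₃ ∷ [] ⊆ crossPairs G
      ⊆crossPairs (here refl)                 = ∈-crossPairs⁺ G c₁
      ⊆crossPairs (there (here refl))         = ∈-crossPairs⁺ G c₂
      ⊆crossPairs (there (there (here refl))) = ∈-crossPairs⁺ G c₃

  cross-a : CrossPair G (a , s)
  cross-a = as , deg-a , deg-s

  cross-b : CrossPair G (b , p)
  cross-b = adj-sym (trail-adj (suc k)) , deg-b , deg-trail ≤-refl

  -- If the trail returned to a, then a would carry two cross pairs, none would be left for the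
  -- other three cubic vertices, and so all three would be adjacent to a as well as s.
  a≢b : a ≢ b
  a≢b a≡b with k ≟ 0
  ... | yes k≡0 = trail-turns 0 (trans (cong (λ k → trail (2 + k)) (sym k≡0)) (sym a≡b))
  ... | no k≢0 = contradiction (subst (_≤ 3) (length-cubic-complement ([] ∷ []) (deg-a ∷ []))
                   (≤-trans (degree-≥ G unique adjacent) (≤-reflexive deg-a))) λ { (s≤s (s≤s (s≤s ()))) }
    where
      s≢p : s ≢ p
      s≢p = distinct k (Inner-pred inner) (n≢0⇒n>0 k≢0) (n<1+n k)
      no-cross : ∀ {x w} → degree G x ≡ 3 → a ≢ x → ¬ CrossPair G (x , w)
      no-cross dx a≢x cross = no-three-crossPairs cross-a (subst (λ y → CrossPair G (y , p)) (sym a≡b) cross-b) cross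
        (((s≢p ∘ ,-injectiveʳ) ∷ (a≢x ∘ ,-injectiveˡ) ∷ []) ∷ ((a≢x ∘ ,-injectiveˡ) ∷ []) ∷ [] ∷ [])
      others : List (Fin (5 + m))
      others = cubic-complement (a ∷ [])
      unique : Unique (s ∷ others)
      unique = All.tabulate (λ x∈ → 2≢3 deg-s (proj₁ (∈-cubic-complement⁻ x∈))) ∷ cubic-complement-unique _
      adjacent : Adjacent-to G a (s ∷ others)
      adjacent = as ∷ All.tabulate λ x∈ → let (dx , x∉) = ∈-cubic-complement⁻ x∈ in
        adj-sym (cubic-without-crossPairs-adjacent dx (no-cross dx (x∉ ∘ here ∘ sym)) deg-a (x∉ ∘ here))

  private
    two-elements : ∀ {A : Set} (xs : List A) → length xs ≡ 2 → ∃ λ x → ∃ λ y → xs ≡ x ∷ y ∷ []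
    two-elements (x ∷ y ∷ []) refl = x , y , refl

  opaque
    rest≡cd : ∃ λ c → ∃ λ d → cubic-complement (a ∷ b ∷ []) ≡ c ∷ d ∷ []
    rest≡cd = two-elements _ (+-cancelˡ-≡ 2 _ _ (length-cubic-complement ((a≢b ∷ []) ∷ [] ∷ []) (deg-a ∷ deg-b ∷ [])))

  c d : Fin (5 + m)
  c = proj₁ rest≡cd
  d = proj₁ (proj₂ rest≡cd)

  private
    in-rest : ∀ {x} → x ∈ c ∷ d ∷ [] → degree G x ≡ 3 × x ∉ a ∷ b ∷ []
    in-rest = ∈-cubic-complement⁻ ∘ subst (_ ∈_) (sym (proj₂ (proj₂ rest≡cd)))

    outside : ∀ {x y} → x ∈ c ∷ d ∷ [] → y ∈ a ∷ b ∷ [] → y ≢ x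
    outside x∈ y∈ refl = proj₂ (in-rest x∈) y∈

    no-cross : ∀ {x w} → x ∈ c ∷ d ∷ [] → ¬ CrossPair G (x , w)
    no-cross x∈ cross = no-three-crossPairs cross-a cross-b cross
      (((a≢b ∘ ,-injectiveˡ) ∷ (outside x∈ (here refl) ∘ ,-injectiveˡ) ∷ []) ∷
       ((outside x∈ (there (here refl)) ∘ ,-injectiveˡ) ∷ []) ∷ [] ∷ [])

    adjacent-to : ∀ {x y} → x ∈ c ∷ d ∷ [] → degree G y ≡ 3 → x ≢ y → G x y ≡ true
    adjacent-to x∈ = cubic-without-crossPairs-adjacent (proj₁ (in-rest x∈)) (no-cross x∈)

    c∈ : c ∈ c ∷ d ∷ []
    c∈ = here refl

    d∈ : d ∈ c ∷ d ∷ []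
    d∈ = there (here refl)

    a∈ : a ∈ a ∷ b ∷ []
    a∈ = here refl

    b∈ : b ∈ a ∷ b ∷ []
    b∈ = there (here refl)

  c≢d : c ≢ d
  c≢d with subst Unique (proj₂ (proj₂ rest≡cd)) (cubic-complement-unique _)
  ... | (c≢d ∷ []) ∷ _ = c≢d

  deg-c : degree G c ≡ 3
  deg-c = proj₁ (in-rest c∈)

  deg-d : degree G d ≡ 3
  deg-d = proj₁ (in-rest d∈)

  nbhd-c : Neighbourhood G c (a ∷ b ∷ d ∷ [])
  nbhd-c = neighbourhood G ((a≢b ∷ outside d∈ a∈ ∷ []) ∷ (outside d∈ b∈ ∷ []) ∷ [] ∷ [])
    (adjacent-to c∈ deg-a (outside c∈ a∈ ∘ sym) ∷ adjacent-to c∈ deg-b (outside c∈ b∈ ∘ sym) ∷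
     adjacent-to c∈ deg-d c≢d ∷ [])
    (≤-reflexive deg-c)

  nbhd-d : Neighbourhood G d (a ∷ b ∷ c ∷ [])
  nbhd-d = neighbourhood G ((a≢b ∷ outside c∈ a∈ ∷ []) ∷ (outside c∈ b∈ ∷ []) ∷ [] ∷ [])
    (adjacent-to d∈ deg-a (outside d∈ a∈ ∘ sym) ∷ adjacent-to d∈ deg-b (outside d∈ b∈ ∘ sym) ∷
     adjacent-to d∈ deg-c (c≢d ∘ sym) ∷ [])
    (≤-reflexive deg-d)

  nbhd-a : Neighbourhood G a (s ∷ c ∷ d ∷ [])
  nbhd-a = neighbourhood G ((2≢3 deg-s deg-c ∷ 2≢3 deg-s deg-d ∷ []) ∷ (c≢d ∷ []) ∷ [] ∷ [])
    (as ∷ adj-sym (Equivalence.from nbhd-c (here refl)) ∷ adj-sym (Equivalence.from nbhd-d (here refl)) ∷ [])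
    (≤-reflexive deg-a)

  nbhd-b : Neighbourhood G b (p ∷ c ∷ d ∷ [])
  nbhd-b = neighbourhood G ((2≢3 (deg-trail ≤-refl) deg-c ∷ 2≢3 (deg-trail ≤-refl) deg-d ∷ []) ∷ (c≢d ∷ []) ∷ [] ∷ [])
    (adj-sym (trail-adj (suc k)) ∷ adj-sym (Equivalence.from nbhd-c (there (here refl))) ∷
     adj-sym (Equivalence.from nbhd-d (there (here refl))) ∷ [])
    (≤-reflexive deg-b)

  private
    a≢trail : ∀ {j} → j ≤ suc k → a ≢ trail (suc j)
    a≢trail j≤1+k with m≤n⇒m<n∨m≡n j≤1+k
    ... | inj₁ j<1+k = 2≢3 (deg-trail (≤-pred j<1+k)) deg-a ∘ sym
    ... | inj₂ refl  = a≢b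

  trail-injective : ∀ {i j} → i ≤ 2 + k → j ≤ 2 + k → trail i ≡ trail j → i ≡ j
  trail-injective {zero}  {zero}  _  _  _  = refl
  trail-injective {zero}  {suc j} _  j≤ eq = contradiction eq (a≢trail (≤-pred j≤))
  trail-injective {suc i} {zero}  i≤ _  eq = contradiction (sym eq) (a≢trail (≤-pred i≤))
  trail-injective {suc i} {suc j} i≤ j≤ eq = cong suc (distinct⇒injective (distinct (suc k) inner) i≤ j≤ eq)

  off-trail : ∀ {i x} → x ∈ c ∷ d ∷ [] → i ≤ 2 + k → trail i ≢ x
  off-trail {zero}  x∈ _  = outside x∈ a∈
  off-trail {suc i} x∈ i≤ with m≤n⇒m<n∨m≡n (≤-pred i≤)
  ... | inj₁ i<1+k = 2≢3 (deg-trail (≤-pred i<1+k)) (proj₁ (in-rest x∈))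
  ... | inj₂ refl  = outside x∈ b∈

  -- The vertices of T_(5+k) as labels of G: the path 0, …, 2 + k is sent along the trail from a
  -- to b, and the apices u = 3 + k, v = 4 + k are sent to c, d.
  label : ℕ → Fin (5 + m)
  label x with x ≤? 2 + k
  ... | yes _ = trail x
  ... | no _ with x ≟ 3 + k
  ...   | yes _ = c
  ...   | no _  = d

  label-trail : ∀ {x} → x ≤ 2 + k → label x ≡ trail x
  label-trail {x} x≤ with x ≤? 2 + k
  ... | yes _ = refl
  ... | no x≰ = contradiction x≤ x≰

  label-c : label (3 + k) ≡ c
  label-c with (3 + k) ≤? 2 + k
  ... | yes 3+k≤2+k = contradiction 3+k≤2+k 1+n≰n
  ... | no _ with (3 + k) ≟ 3 + k
  ...   | yes _ = refl
  ...   | no ne = contradiction refl ne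

  label-d : label (4 + k) ≡ d
  label-d with (4 + k) ≤? 2 + k
  ... | yes 4+k≤2+k = contradiction (≤-trans (n≤1+n _) 4+k≤2+k) 1+n≰n
  ... | no _ with (4 + k) ≟ 3 + k
  ...   | yes eq = contradiction eq (<⇒≢ (n<1+n (3 + k)) ∘ sym)
  ...   | no _   = refl

  open Tₙ k using (Kind; end-a; mid; end-b; apex-u; apex-v; kind; nbrsT; nbrsT-<)

  private
    [_,_,_]≡ : ∀ {x x′ y y′ z z′ : Fin (5 + m)} → x ≡ x′ → y ≡ y′ → z ≡ z′ →
      _≡_ {A = List (Fin (5 + m))} (x ∷ y ∷ z ∷ []) (x′ ∷ y′ ∷ z′ ∷ [])
    [ refl , refl , refl ]≡ = refl

    label-a : label 0 ≡ a
    label-a = label-trail z≤n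

    label-b : label (2 + k) ≡ b
    label-b = label-trail ≤-refl

  label-nbhd : ∀ {x} (κ : Kind x) → Neighbourhood G (label x) (map label (nbrsT κ))
  label-nbhd end-a = subst₂ (Neighbourhood G) (sym label-a) (sym [ label-trail (s≤s z≤n) , label-c , label-d ]≡) nbhd-a
  label-nbhd (mid {i} i≤k) = subst₂ (Neighbourhood G) (sym (label-trail (s≤s (m≤n⇒m≤1+n i≤k))))
    (sym (cong₂ _∷_ (label-trail (m≤n⇒m≤1+n (m≤n⇒m≤1+n i≤k))) (cong (_∷ []) (label-trail (s≤s (s≤s i≤k))))))
    (nbhd-inner {i} (deg-trail i≤k))
  label-nbhd end-b  = subst₂ (Neighbourhood G) (sym label-b) (sym [ label-trail (n≤1+n _) , label-c , label-d ]≡) nbhd-b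
  label-nbhd apex-u = subst₂ (Neighbourhood G) (sym label-c) (sym [ label-a , label-b , label-d ]≡) nbhd-c
  label-nbhd apex-v = subst₂ (Neighbourhood G) (sym label-d) (sym [ label-a , label-b , label-c ]≡) nbhd-d

  private
    data Position : ℕ → Set where
      on-trail : ∀ {x} → x ≤ 2 + k → Position x
      at-c     : Position (3 + k)
      at-d     : Position (4 + k)

    position : ∀ {x} → Kind x → Position x
    position end-a     = on-trail z≤n
    position (mid i≤k) = on-trail (s≤s (m≤n⇒m≤1+n i≤k))
    position end-b     = on-trail ≤-refl
    position apex-u    = at-c
    position apex-v    = at-d

  label-injective : ∀ {x y} → x < 5 + k → y < 5 + k → label x ≡ label y → x ≡ y
  label-injective x< y< = same (position (kind x<)) (position (kind y<))
    where
      same : ∀ {x y} → Position x → Position y → label x ≡ label y → x ≡ y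
      same (on-trail x≤) (on-trail y≤) eq = trail-injective x≤ y≤ (trans (sym (label-trail x≤)) (trans eq (label-trail y≤)))
      same (on-trail x≤) at-c eq = contradiction (trans (sym (label-trail x≤)) (trans eq label-c)) (off-trail c∈ x≤)
      same (on-trail x≤) at-d eq = contradiction (trans (sym (label-trail x≤)) (trans eq label-d)) (off-trail d∈ x≤)
      same at-c (on-trail y≤) eq = contradiction (trans (sym (label-trail y≤)) (trans (sym eq) label-c)) (off-trail c∈ y≤)
      same at-c at-c _           = refl
      same at-c at-d eq          = contradiction (trans (sym label-c) (trans eq label-d)) c≢d
      same at-d (on-trail y≤) eq = contradiction (trans (sym (label-trail y≤)) (trans (sym eq) label-d)) (off-trail d∈ y≤)
      same at-d at-c eq          = contradiction (trans (sym label-c) (trans (sym eq) label-d)) c≢d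
      same at-d at-d _           = refl

  label-onto : ∀ w → ∃ λ x → x < 5 + k × label x ≡ w
  label-onto = closed-set-is-everything G connected closed (0 , s≤s z≤n , label-a)
    where
      closed : ∀ {w w′} → G w w′ ≡ true → (∃ λ x → x < 5 + k × label x ≡ w) → ∃ λ y → y < 5 + k × label y ≡ w′
      closed ww′ (x , x< , refl) with ∈-map⁻ label (Equivalence.to (label-nbhd (kind x<)) ww′)
      ... | y , y∈ , refl = y , All.lookup (nbrsT-< (kind x<)) y∈ , refl

  -- label is a bijection between {0, …, 4 + k} and the 5 + m vertices of G.
  trail-length : k ≡ m
  trail-length = +-cancelˡ-≡ 5 k m (≤-antisym (injective⇒≤ labels-injective) (injective⇒≤ positions-injective))
    where
      labels-injective : ∀ {i j : Fin (5 + k)} → label (toℕ i) ≡ label (toℕ j) → i ≡ j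
      labels-injective {i} {j} = toℕ-injective ∘ label-injective (toℕ<n i) (toℕ<n j)
      position-of : Fin (5 + m) → Fin (5 + k)
      position-of w = fromℕ< (proj₁ (proj₂ (label-onto w)))
      positions-injective : ∀ {w w′} → position-of w ≡ position-of w′ → w ≡ w′
      positions-injective {w} {w′} eq = trans (sym (proj₂ (proj₂ (label-onto w))))
        (trans (cong label (trans (sym (toℕ-fromℕ< _)) (trans (cong toℕ eq) (toℕ-fromℕ< _)))) (proj₂ (proj₂ (label-onto w′))))

module Isomorphism (m : ℕ) (G : Graph (5 + m)) (simple : Simple G) (connected : Connected G)
  (deg : ∀ x → Deg₂₃ (degree G x)) (four : length (cubicVertices G) ≡ 4) (few-cross : length (crossPairs G) ≤ 2)
  (a s : Fin (5 + m)) (as : G a s ≡ true) (deg-a : degree G a ≡ 3) (deg-s : degree G s ≡ 2)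
  (inner : DegreeTwoTrail.Inner G simple deg a s as deg-a deg-s (suc m))
  (deg-b : degree G (DegreeTwoTrail.trail G simple deg a s as deg-a deg-s (2 + m)) ≡ 3) where

  open Labelling m G simple connected deg four few-cross a s as deg-a deg-s m inner deg-b
  open Tₙ m using (T⇔TAdj; kind-of; TAdj⇒∈nbrsT; ∈nbrsT⇒TAdj; nbrsT-<)

  relabel : Fin (5 + m) → Fin (5 + m)
  relabel i = label (toℕ i)

  relabel-adjacent : ∀ i j → G (relabel i) (relabel j) ≡ T (5 + m) i j
  relabel-adjacent i j = ⇔→≡ (mk⇔ G⇒T T⇒G)
    where
      G⇒T : G (relabel i) (relabel j) ≡ true → T (5 + m) i j ≡ true
      G⇒T ij with ∈-map⁻ label (Equivalence.to (label-nbhd (kind-of i)) ij)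
      ... | y , y∈ , j≡y = Equivalence.from (T⇔TAdj i j) (∈nbrsT⇒TAdj (kind-of i)
        (subst (_∈ _) (sym (label-injective (toℕ<n j) (All.lookup (nbrsT-< (kind-of i)) y∈) j≡y)) y∈))
      T⇒G : T (5 + m) i j ≡ true → G (relabel i) (relabel j) ≡ true
      T⇒G ij = Equivalence.from (label-nbhd (kind-of i)) (∈-map⁺ label (TAdj⇒∈nbrsT (kind-of i) (Equivalence.to (T⇔TAdj i j) ij)))

  isomorphic : Iso G (T (5 + m))
  isomorphic = Iso-by-relabelling relabel (λ {i} {j} → toℕ-injective ∘ label-injective (toℕ<n i) (toℕ<n j)) onto relabel-adjacent
    where
      onto : ∀ w → ∃ λ i → relabel i ≡ w
      onto w with label-onto w
      ... | x , x< , x↦w = fromℕ< x< , trans (cong label (toℕ-fromℕ< x<)) x↦w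

-- Maximality of T_n

module _ (m : ℕ) (G : Graph (5 + m)) (simple : Simple G) (connected : Connected G) where

  private
    n : ℕ
    n = 5 + m

  has-neighbour : ∀ u → ∃ λ v → G u v ≡ true
  has-neighbour u = first-step (connected u (other u)) (other≢ u)
    where
      other : Fin n → Fin n
      other Fin.zero    = Fin.suc Fin.zero
      other (Fin.suc _) = Fin.zero
      other≢ : ∀ u → u ≢ other u
      other≢ Fin.zero    ()
      other≢ (Fin.suc _) ()
      first-step : ∀ {x y} → Walk G x y → x ≢ y → ∃ λ v → G x v ≡ true
      first-step here         x≢x = contradiction refl x≢x
      first-step (step xw _) _   = _ , xw

  no-adjacent-leaves : ∀ {u v} → G u v ≡ true → degree G u ≡ 1 → degree G v ≡ 1 → ⊥
  no-adjacent-leaves {u} {v} uv du dv =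
    contradiction (length-≥-of-cover (closed-set-is-everything G connected closed (here refl))) λ { (s≤s (s≤s ())) }
    where
      only : ∀ {x y} → G x y ≡ true → degree G x ≡ 1 → ∀ {w} → G x w ≡ true → w ≡ y
      only xy dx xw with Equivalence.to (neighbourhood G ([] ∷ []) (xy ∷ []) (≤-reflexive dx)) xw
      ... | here w≡y = w≡y
      closed : ∀ {x y} → G x y ≡ true → x ∈ u ∷ v ∷ [] → y ∈ u ∷ v ∷ []
      closed xy (here refl)         = there (here (only uv du xy))
      closed xy (there (here refl)) = here (only (adjacent-sym G simple uv) dv xy)

  four-cubic : (∀ x → Deg₂₃ (degree G x)) → edgeCount G ≡ n + 2 → length (cubicVertices G) ≡ 4
  four-cubic deg edges = +-cancelˡ-≡ (2 * n) _ _ (begin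
    2 * n + length (cubicVertices G) ≡⟨ degree-sum-Deg₂₃ G deg ⟨
    ∑[ i < n ] degree G i            ≡⟨ handshake G simple ⟨
    2 * edgeCount G                  ≡⟨ cong (2 *_) edges ⟩
    2 * (n + 2)                      ≡⟨ *-distribˡ-+ 2 n 2 ⟩
    2 * n + 4                        ∎)
    where open ≡-Reasoning

  cross-edge : (∀ x → Deg₂₃ (degree G x)) → length (cubicVertices G) ≡ 4 →
    ∃ λ a → ∃ λ s → G a s ≡ true × degree G a ≡ 3 × degree G s ≡ 2
  cross-edge deg four = from-degree-two (any? (λ x → degree G x ≟ 2))
    where
      some-member : ∀ {xs : List (Fin n)} → length xs ≡ 4 → ∃ (_∈ xs)
      some-member {x ∷ _} _ = x , here refl
      cubic : ∃ (_∈ cubicVertices G)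
      cubic = some-member four
      from-degree-two : Dec (∃ λ y → degree G y ≡ 2) → ∃ λ a → ∃ λ s → G a s ≡ true × degree G a ≡ 3 × degree G s ≡ 2
      from-degree-two (no none) =
        contradiction (subst (n ≤_) four (length-≥-of-cover all-cubic)) λ { (s≤s (s≤s (s≤s (s≤s ())))) }
        where
          all-cubic : ∀ x → x ∈ cubicVertices G
          all-cubic x = ∈-cubicVertices⁺ G (Deg₂₃-≢2 (deg x) (λ d≡2 → none (x , d≡2)))
      from-degree-two (yes (y , dy)) with crossing-edge G connected (λ x → degree G x ≟ 3)
        (∈-cubicVertices⁻ G (proj₂ cubic)) (λ dy≡3 → contradiction (trans (sym dy) dy≡3) λ ())
      ... | a , s , as , deg-a , ¬deg-s = a , s , as , deg-a , Deg₂₃-≢3 (deg s) ¬deg-s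

  isomorphic-to-T : (deg : ∀ x → Deg₂₃ (degree G x)) (four : length (cubicVertices G) ≡ 4) →
    length (crossPairs G) ≤ 2 → Iso G (T n)
  isomorphic-to-T deg four few-cross = from-edge (cross-edge deg four)
    where
      from-edge : (∃ λ a → ∃ λ s → G a s ≡ true × degree G a ≡ 3 × degree G s ≡ 2) → Iso G (T n)
      from-edge (a , s , as , deg-a , deg-s) = from-trail (first-cubic)
        where
          open DegreeTwoTrail G simple deg a s as deg-a deg-s using (Inner; trail; first-cubic)
          by-length : ∀ k (inner : Inner (suc k)) (deg-b : degree G (trail (2 + k)) ≡ 3) → k ≡ m → Iso G (T n)
          by-length k inner deg-b refl = Isomorphism.isomorphic m G simple connected deg four few-cross a s as deg-a deg-s inner deg-b
          from-trail : (∃ λ k → Inner (suc k) × degree G (trail (2 + k)) ≡ 3) → Iso G (T n)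
          from-trail (k , inner , deg-b) =
            by-length k inner deg-b (Labelling.trail-length m G simple connected deg four few-cross a s as deg-a deg-s k inner deg-b)

  module _ (edges : edgeCount G ≡ n + 2) (max3 : MaxDegree≤3 G) where

    degrees : ∀ x → Deg (degree G x)
    degrees x = between (degree-≥ G ([] ∷ []) (proj₂ (has-neighbour x) ∷ [])) (max3 x)
      where
        between : ∀ {d} → 1 ≤ d → d ≤ 3 → Deg d
        between {1} _ _ = deg1
        between {2} _ _ = deg2
        between {3} _ _ = deg3
        between {suc (suc (suc (suc _)))} _ (s≤s (s≤s (s≤s ())))

    15≤totalGap : ¬ Iso G (T n) → 15 ≤ totalGap G upper720
    15≤totalGap ¬iso = by-leaf (any? (λ u → degree G u ≟ 1))
      where
        no-leaf⇒Deg₂₃ : ∀ {d} → Deg d → d ≢ 1 → Deg₂₃ d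
        no-leaf⇒Deg₂₃ deg1 d≢1 = contradiction refl d≢1
        no-leaf⇒Deg₂₃ deg2 _   = deg2
        no-leaf⇒Deg₂₃ deg3 _   = deg3
        by-crossPairs : (deg : ∀ x → Deg₂₃ (degree G x)) → Dec (length (crossPairs G) ≤ 2) → 15 ≤ totalGap G upper720
        by-crossPairs deg (yes few) = contradiction (isomorphic-to-T deg (four-cubic deg edges) few) ¬iso
        by-crossPairs deg (no many) = begin
          15                        ≤⟨ ≤ᵇ⇒≤ 15 18 _ ⟩
          6 * 3                     ≤⟨ *-monoʳ-≤ 6 (≰⇒> many) ⟩
          6 * length (crossPairs G) ≡⟨ totalGap≡crossPairs G simple deg upper720 6 gap-upper720 ⟨
          totalGap G upper720       ∎
          where open ≤-Reasoning
        by-leaf : Dec (∃ λ u → degree G u ≡ 1) → 15 ≤ totalGap G upper720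
        by-leaf (yes (u , du)) with has-neighbour u
        ... | v , uv = leaf⇒15≤totalGap G simple uv du (degrees v) (no-adjacent-leaves uv du)
        by-leaf (no no-leaf) =
          by-crossPairs (λ x → no-leaf⇒Deg₂₃ (degrees x) (λ d≡1 → no-leaf (x , d≡1))) (length (crossPairs G) ≤? 2)

    T-maximal : ¬ Iso G (T n) → RandicLt G (T n)
    T-maximal ¬iso = RandicLt-by-totalGap G (T n) simple degrees (Tₙ.T-simple m) (Deg₂₃⇒Deg ∘ Tₙ.T-Deg₂₃ m)
      (subst (_< totalGap G upper720) (sym (Tₙ.T-totalGap m)) (15≤totalGap ¬iso))

mainTheorem5 : (n : ℕ) → 5 ≤ n →
    InG3 n (n + 2) (T n) ×
    ((G : Graph n) → InG3 n (n + 2) G → ¬ Iso G (T n) → RandicLt G (T n))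
mainTheorem5 _ (s≤s (s≤s (s≤s (s≤s (s≤s {n = m} z≤n))))) =
  Tₙ.T-InG3 m , λ G (simple , connected , edges , max3) → T-maximal m G simple connected edges max3
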